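{- Let $n \geq 1$. The map $\Phi$ restricted to the facets of $\Delta_{n,n-1}$ is a bijection onto $S^D_n$, and $\Phi(\Delta_{n,n-1}) = S^D_n$. Moreover, for $0 \leq m \leq n-1$ with $m$ even, $\Phi$ restricted to the facets of $\Delta_{n,m}$ is a bijection onto $S^D_{n,m}$, and $\Phi(\Delta_{n,m}) = S^D_{n,m}$.
   Context: Sign vectors: elements of $\{ -,0,+\}^n$. For a sign vector $\omega$, $\operatorname{var}(\omega)$ is the number of sign changes in the sequence obtained from $\omega$ by deleting its zero entries, and $\operatorname{wt}(\omega)$ is the number of nonzero entries. $\mathcal{PV}_n$ is the set of nonzero sign vectors of length $n$ modulo $\omega \sim -\omega$. For $0 \leq m < n$, $P_{n,m}$ is the poset on $\{\omega \in \mathcal{PV}_n : \operatorname{var}(\omega) \leq m\}$ with $\omega' < \omega$ iff $\omega'$ or $-\omega'$ is obtained from $\omega$ by replacing some nonzero entries with $0$. $\Delta_{n,m}$ is the order complex of $P_{n,m}$; its faces are the chains $\omega^{(1)} < \cdots < \omega^{(r)}$, $r \geq 0$, and its facets are the maximal chains. Cyclic sign flips: indices are read cyclically ($\omega_{i+n} = \omega_i$); $i \in [n]$ is a cyclic sign flip of $\omega$ if there is $j \geq 1$ with $\omega_{i-j}\omega_i < 0$ and $\omega_{i-k}\omega_i = 0$ for $1 \leq k < j$. $\operatorname{BAR}(\omega)$ is the set of cyclic sign flips (so $\operatorname{BAR}(0^n) = \emptyset$). Signed permutations: a bijection $\pi$ of $\{\pm 1, \dots, \pm n\}$ with $\pi(-i)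 = -\pi(i)$, written in window notation $\pi(1)\cdots\pi(n)$. $S^D_n$ is the set of signed permutations with an even number of negative entries in window notation; $S^D_{n,m}$ is the set of those in $S^D_n$ with at most $m$ negative entries. The map $\Phi$: for a chain $C: \omega^{(1)} < \cdots < \omega^{(r)}$ in $P_{n,m}$ set $\omega^{(0)} = 0^n$. For $s = 1, \dots, r$ let $I_s = \{i \in [n] : \omega^{(s)}_i \neq 0, \omega^{(s-1)}_i = 0\}$, and $I_{r+1} = \{i \in [n] : \omega^{(r)}_i = 0\}$. For $1 \leq s \leq r+1$ let $\bar{I}_s = \{i : i \in I_s, i \notin \operatorname{BAR}(\omega^{(r)})\} \cup \{ -i : i \in I_s, i \in \operatorname{BAR}(\omega^{(r)})\}$, and $\omega'_s$ the word listing $\bar{I}_s$ in increasing order. Then $\Phi(C)$ is the signed permutation with window notation $\omega'_{r+1}\omega'_r\cdots\omega'_1$. $\Phi(\Delta_{n,m})$ denotes the set of values of $\Phi$ on all faces of $\Delta_{n,m}$. -}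

module Defs where

open import Data.Bool using (Bool; true; false; _∧_; _∨_; not; if_then_else_)
open import Data.Nat using (ℕ; zero; suc; _+_; _*_; _∸_; _≤_; _%_)
open import Data.Nat.DivMod using (m%n<n)
open import Data.Nat.Divisibility using (_∣_)
open import Data.Integer using (ℤ; +_; -_; ∣_∣; _<_)
open import Data.Integer.Properties using (_<?_)
open import Data.Fin using (Fin; toℕ; fromℕ<)
open import Data.Vec using (Vec; []; _∷_; lookup; replicate; toList; map)
open import Data.List using (List; []; _∷_; _++_; filter; length; reverse; concat; applyUpTo; allFin; last)
import Data.List as L
open import Data.List.Membership.Propositional using (_∈_)
open import Data.List.Relation.Unary.All using (All)
open import Data.List.Relation.Unary.Linked using (Linked)
open import Data.List.Relation.Binary.Permutation.Propositional using (_↭_)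
open import Data.Maybe using (Maybe; just; nothing)
open import Data.Product using (Σ; ∃; _×_; _,_; proj₁)
open import Data.Sum using (_⊎_)
open import Relation.Binary.PropositionalEquality using (_≡_; _≢_)
open import Relation.Nullary.Decidable using (does)

data Sign : Set where
  sm s0 sp : Sign

isNz : Sign → Bool
isNz s0 = false
isNz _  = true

negS : Sign → Sign
negS sm = sp
negS s0 = s0
negS sp = sm

_·_ : Sign → Sign → Sign
s0 · _  = s0
_  · s0 = s0
sp · sp = sp
sm · sm = sp
sp · sm = sm
sm · sp = sm

SignVec : ℕ → Set
SignVec n = Vec Sign n

zeroVec : ∀ n → SignVec n
zeroVec n = replicate n s0

negV : ∀ {n} → SignVec n → SignVec n
negV = map negS

nonzeros : ∀ {n} → SignVec n → List Sign
nonzeros ω = filter isNzDec (toList ω)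
  where
  open import Relation.Nullary using (Dec; yes; no)
  open import Relation.Binary.PropositionalEquality using (refl)
  isNzDec : (s : Sign) → Dec (isNz s ≡ true)
  isNzDec sm = yes refl
  isNzDec s0 = no (λ ())
  isNzDec sp = yes refl

signChanges : List Sign → ℕ
signChanges []           = 0
signChanges (_ ∷ [])     = 0
signChanges (a ∷ b ∷ xs) =
  (if isNeg (a · b) then 1 else 0) + signChanges (b ∷ xs)
  where
  isNeg : Sign → Bool
  isNeg sm = true
  isNeg _  = false

var : ∀ {n} → SignVec n → ℕ
var ω = signChanges (nonzeros ω)

-- PV_n : nonzero sign vectors modulo ω ~ -ω.
-- Each class is represented by its unique member whose first nonzero
-- entry is +.

firstNz : List Sign → Maybe Sign
firstNz []        = nothing
firstNz (s0 ∷ xs) = firstNz xs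
firstNz (s  ∷ xs) = just s

PV : ℕ → Set
PV n = Σ (SignVec n) (λ ω → firstNz (toList ω) ≡ just sp)

ZeroOut : ∀ {n} → SignVec n → SignVec n → Set
ZeroOut {n} ω' ω = (i : Fin n) → (lookup ω' i ≡ s0) ⊎ (lookup ω' i ≡ lookup ω i)

_<P_ : ∀ {n} → PV n → PV n → Set
(ω' , _) <P (ω , _) = (ZeroOut ω' ω ⊎ ZeroOut (negV ω') ω) × ω' ≢ ω

InP : ∀ {n} → ℕ → PV n → Set
InP m (ω , _) = var ω ≤ m

-- faces of Δ_{n,m}: chains ω⁽¹⁾ < ⋯ < ω⁽ʳ⁾ of P_{n,m}, listed increasingly
IsFace : ∀ {n} → ℕ → List (PV n) → Set
IsFace m C = All (InP m) C × Linked _<P_ C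

IsFacet : ∀ {n} → ℕ → List (PV n) → Set
IsFacet {n} m C =
  IsFace m C ×
  ((D : List (PV n)) → IsFace m D → (∀ x → x ∈ C → x ∈ D) → (∀ x → x ∈ D → x ∈ C))

-- ω_{i-j} with cyclic indices (0-based i); for length suc k,  i - j ≡ i + j*k  (mod suc k)
cycBack : ∀ {n} → SignVec n → Fin n → ℕ → Sign
cycBack {suc k} ω i j = lookup ω (fromℕ< (m%n<n (toℕ i + j * k) (suc k)))

-- i is a cyclic sign flip: ∃ j ≥ 1, ω_{i-j}ω_i < 0 and ω_{i-k}ω_i = 0 for 1 ≤ k < j.
-- The search over j is bounded by n.
isFlipFrom : ∀ {n} → SignVec n → Fin n → ℕ → ℕ → Bool
isFlipFrom ω i j zero    = false
isFlipFrom ω i j (suc b) with cycBack ω i j · lookup ω i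
... | sm = true
... | s0 = isFlipFrom ω i (suc j) b
... | sp = false

inBAR : ∀ {n} → SignVec n → Fin n → Bool
inBAR {n} ω i = isFlipFrom ω i 1 n

-- I_1, …, I_r  (as characteristic functions), starting from ω⁽⁰⁾ = prev
blocks : ∀ {n} → SignVec n → List (SignVec n) → List (Fin n → Bool)
blocks prev []       = []
blocks prev (w ∷ ws) = (λ i → isNz (lookup w i) ∧ not (isNz (lookup prev i))) ∷ blocks w ws

topOf : ∀ {n} → List (SignVec n) → SignVec n
topOf {n} ws with last ws
... | just w  = w
... | nothing = zeroVec n

idxℤ : ∀ {n} → Fin n → ℤ
idxℤ i = + suc (toℕ i)

-- the word listing  Ī  in increasing order (as integers)
word : ∀ {n} → (Fin n → Bool) → (Fin n → Bool) → List ℤ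
word {n} bar I =
  L.map (λ i → - idxℤ i) (reverse (L.filter (λ i → Data.Bool._≟_ (I i ∧ bar i) true) (allFin n)))
  ++ L.map idxℤ (L.filter (λ i → Data.Bool._≟_ (I i ∧ not (bar i)) true) (allFin n))
  where import Data.Bool

Φv : ∀ {n} → List (SignVec n) → List ℤ
Φv {n} ws =
  concat (L.map (word (inBAR top))
    (reverse (blocks (zeroVec n) ws L.++ ((λ i → not (isNz (lookup top i))) ∷ []))))
  where top = topOf ws

Φ : ∀ {n} → List (PV n) → List ℤ
Φ C = Φv (L.map proj₁ C)

negCount : List ℤ → ℕ
negCount π = length (L.filter (λ z → z <? + 0) π)

-- window notation of a signed permutation of [n]
IsSignedPerm : ℕ → List ℤ → Set
IsSignedPerm n π = L.map ∣_∣ π ↭ applyUpTo suc n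

InSD : ℕ → List ℤ → Set
InSD n π = IsSignedPerm n π × 2 ∣ negCount π

InSDm : ℕ → ℕ → List ℤ → Set
InSDm n m π = InSD n π × negCount π ≤ m

PhiClaim : (n m : ℕ) → (List ℤ → Set) → Set
PhiClaim n m S =
  ((C : List (PV n)) → IsFacet m C → S (Φ C)) ×
  ((C D : List (PV n)) → IsFacet m C → IsFacet m D → Φ C ≡ Φ D → C ≡ D) ×
  ((π : List ℤ) → S π → Σ (List (PV n)) λ C → IsFacet m C × Φ C ≡ π) ×
  ((C : List (PV n)) → IsFace m C → S (Φ C)) ×
  ((π : List ℤ) → S π → Σ (List (PV n)) λ C → IsFace m C × Φ C ≡ π)

module Submission where

-- For a chain C the blocks I_1, …, I_{r+1} partition [n], so Φ(C) is a
--    signed permutation whose negative entries are BAR of the top element ω⁽ʳ⁾.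
--    Reading the cyclic definition of BAR concretely, |BAR(ω)| is the number of sign
--    changes of the cyclic sequence of nonzero entries of ω: it is even and at most
--    var(ω) + 1, hence at most m when var(ω) ≤ m and m is even (face-SD, face-SDm).
--  * Facets.  Strict relations in P_n raise the weight, so faces have at most n
--    elements; a chain that skips a weight or whose top has a zero entry can be
--    extended inside P_{n,m}.  Hence a facet is a flag of normalised restrictions of a
--    full vector t along an enumeration js of [n] (facet-is-flag), and Φ of that flag
--    is js reversed, signed by BAR(t) (Φ-chain).
--  * Bijection.  A full representative t is determined by BAR(t) (bar-det), giving
--    injectivity; conversely every sign pattern of even size is BAR of a full t, and
--    var(t) ≤ |BAR(t)|, giving surjectivity (facet-surj).

open import Defs
open import Data.Bool using (Bool; true; false; _∧_; _∨_; not; if_then_else_; _xor_)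
open import Data.Bool.Properties using (∨-zeroʳ; ∨-identityʳ; not-involutive; xor-same)
import Data.Bool as B
open import Data.Empty using (⊥; ⊥-elim)
open import Data.Fin using (Fin; zero; suc; toℕ; fromℕ<)
open import Data.Fin.Properties using (toℕ-fromℕ<; toℕ-injective; fromℕ<-toℕ; toℕ<n)
open import Data.Integer using (ℤ; -_; ∣_∣; -[1+_])
import Data.Integer as Z
import Data.Integer.Properties as ZP
open import Data.List using (List; []; _∷_; _++_; concat; reverse; length; allFin; tabulate; applyUpTo; [_]; last)
import Data.List as L
import Data.List.Properties as LP
open import Data.List.Membership.Propositional using (_∈_)
open import Data.List.Membership.Propositional.Properties using (∈-allFin; ∈-map⁻; ∈-map⁺)
open import Data.List.Relation.Binary.Permutation.Propositional using (_↭_; ↭-refl; ↭-trans; ↭-sym; ↭-reflexive; prep)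
import Data.List.Relation.Binary.Permutation.Propositional as Perm
open import Data.List.Relation.Binary.Permutation.Propositional.Properties using (map⁺; ++⁺ˡ; ++⁺ʳ; ++⁺; shift; shifts; ↭-reverse; ↭-length; filter-↭; ∈-resp-↭)
open import Data.List.Relation.Binary.Sublist.Propositional using (_⊆_; []; _∷_; _∷ʳ_)
open import Data.List.Relation.Unary.All using (All; []; _∷_)
import Data.List.Relation.Unary.All as All
open import Data.List.Relation.Unary.AllPairs using (AllPairs; []; _∷_)
import Data.List.Relation.Unary.AllPairs as AP
import Data.List.Relation.Unary.AllPairs.Properties as APP
open import Data.List.Relation.Unary.Any using (here; there)
open import Data.List.Relation.Unary.Linked using (Linked; []; [-]; _∷_)
import Data.List.Relation.Unary.Linked as Lk
open import Data.List.Relation.Unary.Linked.Properties using (Linked⇒AllPairs)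
open import Data.List.Relation.Unary.Unique.Propositional.Properties using (tabulate⁺; allFin⁺)
open import Data.Maybe using (Maybe; just; nothing; _<∣>_)
import Data.Maybe as M
open import Data.Maybe.Properties using (<∣>-identityʳ)
open import Data.Nat using (ℕ; zero; suc; _+_; _*_; _∸_; _≤_; _<_; z≤n; s≤s; _%_)
open import Data.Nat.DivMod using (m%n<n; [m+kn]%n≡m%n; m<n⇒m%n≡m)
open import Data.Nat.Divisibility using (_∣_; divides)
open import Data.Nat.Properties
open import Data.Nat.Tactic.RingSolver using (solve-∀)
open import Data.Product using (Σ; ∃; _×_; _,_; proj₁; proj₂)
open import Data.Sum using (_⊎_; inj₁; inj₂)
open import Data.Unit using (⊤; tt)
open import Data.Vec using (Vec; []; _∷_; lookup; toList)
import Data.Vec as V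
open import Data.Vec.Properties using (lookup∘tabulate; tabulate∘lookup; tabulate-cong; ≡-dec)
open import Relation.Binary.PropositionalEquality using (_≡_; _≢_; refl; sym; trans; cong; cong₂; subst; subst₂; setoid; module ≡-Reasoning)
open import Relation.Nullary using (Dec; yes; no; ¬_; does)
open import Relation.Nullary.Decidable using (True; toWitness)
open import Axiom.UniquenessOfIdentityProofs.WithK using (uip)

ind : Bool → ℕ
ind true = 1
ind false = 0

ind≤1 : ∀ b → ind b ≤ 1
ind≤1 true = s≤s z≤n
ind≤1 false = z≤n

isNz-false : ∀ s → isNz s ≡ false → s ≡ s0
isNz-false s0 _ = refl

negS-inv : ∀ s → negS (negS s) ≡ s
negS-inv sm = refl
negS-inv s0 = refl
negS-inv sp = refl

isNz-negS : ∀ s → isNz (negS s) ≡ isNz s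
isNz-negS sm = refl
isNz-negS s0 = refl
isNz-negS sp = refl

·-negS : ∀ a b → negS a · negS b ≡ a · b
·-negS sm sm = refl
·-negS sm s0 = refl
·-negS sm sp = refl
·-negS s0 b = refl
·-negS sp sm = refl
·-negS sp s0 = refl
·-negS sp sp = refl

_≟S_ : (a b : Sign) → Dec (a ≡ b)
sm ≟S sm = yes refl
sm ≟S s0 = no (λ ())
sm ≟S sp = no (λ ())
s0 ≟S sm = no (λ ())
s0 ≟S s0 = yes refl
s0 ≟S sp = no (λ ())
sp ≟S sm = no (λ ())
sp ≟S s0 = no (λ ())
sp ≟S sp = yes refl

vext : ∀ {n} {a b : SignVec n} → (∀ i → lookup a i ≡ lookup b i) → a ≡ b
vext {a = a} {b} h = trans (sym (tabulate∘lookup a)) (trans (tabulate-cong h) (tabulate∘lookup b))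

lookup-negV : ∀ {n} (ω : SignVec n) i → lookup (negV ω) i ≡ negS (lookup ω i)
lookup-negV (x ∷ ω) zero = refl
lookup-negV (x ∷ ω) (suc i) = lookup-negV ω i

negV-inv : ∀ {n} (ω : SignVec n) → negV (negV ω) ≡ ω
negV-inv [] = refl
negV-inv (x ∷ ω) = cong₂ _∷_ (negS-inv x) (negV-inv ω)

lookup-zero : ∀ n (i : Fin n) → lookup (zeroVec n) i ≡ s0
lookup-zero (suc n) zero = refl
lookup-zero (suc n) (suc i) = lookup-zero n i

supp : ∀ {n} → SignVec n → Fin n → Bool
supp ω i = isNz (lookup ω i)

wt : ∀ {n} → SignVec n → ℕ
wt [] = 0
wt (s ∷ ω) = ind (isNz s) + wt ω

countFin : ∀ {n} → (Fin n → Bool) → ℕ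
countFin {zero} P = 0
countFin {suc n} P = ind (P zero) + countFin (λ i → P (suc i))

countFin-cong : ∀ {n} {P Q : Fin n → Bool} → (∀ i → P i ≡ Q i) → countFin P ≡ countFin Q
countFin-cong {zero} h = refl
countFin-cong {suc n} h = cong₂ _+_ (cong ind (h zero)) (countFin-cong (λ i → h (suc i)))

wt-cnt : ∀ {n} (ω : SignVec n) → wt ω ≡ countFin (supp ω)
wt-cnt [] = refl
wt-cnt (s ∷ ω) = cong (ind (isNz s) +_) (wt-cnt ω)

wt-negV : ∀ {n} (ω : SignVec n) → wt (negV ω) ≡ wt ω
wt-negV [] = refl
wt-negV (s ∷ ω) = cong₂ _+_ (cong ind (isNz-negS s)) (wt-negV ω)

wt-zero : ∀ n → wt (zeroVec n) ≡ 0
wt-zero zero = refl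
wt-zero (suc n) = wt-zero n

wt≤n : ∀ {n} (ω : SignVec n) → wt ω ≤ n
wt≤n [] = z≤n
wt≤n (sm ∷ ω) = s≤s (wt≤n ω)
wt≤n (s0 ∷ ω) = m≤n⇒m≤1+n (wt≤n ω)
wt≤n (sp ∷ ω) = s≤s (wt≤n ω)

-- ZO a b: a is obtained from b by replacing some nonzero entries by 0.  Wrapping the
-- pointwise statement ZeroOut in a record lets Agda infer a and b from proofs.
record ZO {n} (a b : SignVec n) : Set where
  constructor zo
  field app : ZeroOut a b

zo-head : ∀ {n} {x y} {a b : SignVec n} → ZO (x ∷ a) (y ∷ b) → (x ≡ s0) ⊎ (x ≡ y)
zo-head (zo h) = h zero

zo-tail : ∀ {n} {x y} {a b : SignVec n} → ZO (x ∷ a) (y ∷ b) → ZO a b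
zo-tail (zo h) = zo (λ i → h (suc i))

zo-cons : ∀ {n} {x y} {a b : SignVec n} → (x ≡ s0) ⊎ (x ≡ y) → ZO a b → ZO (x ∷ a) (y ∷ b)
zo-cons h (zo t) = zo (λ { zero → h ; (suc i) → t i })

zo-refl : ∀ {n} (a : SignVec n) → ZO a a
zo-refl a = zo (λ i → inj₂ refl)

zo-trans : ∀ {n} {a b c : SignVec n} → ZO a b → ZO b c → ZO a c
zo-trans {a = a} {b} {c} (zo h) (zo g) = zo f where
  f : ZeroOut a c
  f i with h i
  ... | inj₁ e = inj₁ e
  ... | inj₂ e with g i
  ... | inj₁ e' = inj₁ (trans e e')
  ... | inj₂ e' = inj₂ (trans e e')

zo-neg : ∀ {n} {a b : SignVec n} → ZO a b → ZO (negV a) (negV b)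
zo-neg {a = a} {b} (zo h) = zo f where
  f : ZeroOut (negV a) (negV b)
  f i rewrite lookup-negV a i | lookup-negV b i with h i
  ... | inj₁ e = inj₁ (cong negS e)
  ... | inj₂ e = inj₂ (cong negS e)

zo-zero : ∀ {n} (b : SignVec n) → ZO (zeroVec n) b
zo-zero {n} b = zo (λ i → inj₁ (lookup-zero n i))

false≢true : false ≡ true → ⊥
false≢true ()

zo-supp : ∀ {n} {a b : SignVec n} → ZO a b → ∀ i → supp a i ≡ true → supp b i ≡ true
zo-supp (zo h) i e with h i
... | inj₁ z rewrite z = ⊥-elim (false≢true e)
... | inj₂ z rewrite z = e

zo-wt : ∀ {n} {a b : SignVec n} → ZO a b → wt a ≤ wt b
zo-wt {a = []} {[]} h = z≤n
zo-wt {a = x ∷ a} {y ∷ b} h with zo-head h | zo-wt (zo-tail h)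
... | inj₁ refl | r = ≤-trans r (m≤n+m (wt b) (ind (isNz y)))
... | inj₂ refl | r = +-monoʳ-≤ (ind (isNz x)) r

zo-wt-eq : ∀ {n} {a b : SignVec n} → ZO a b → wt a ≡ wt b → a ≡ b
zo-wt-eq {a = []} {[]} h e = refl
zo-wt-eq {a = x ∷ a} {y ∷ b} h e with zo-head h
zo-wt-eq {a = x ∷ a} {y ∷ b} h e | inj₂ refl =
  cong (x ∷_) (zo-wt-eq (zo-tail h) (+-cancelˡ-≡ (ind (isNz x)) _ _ e))
zo-wt-eq {a = s0 ∷ a} {s0 ∷ b} h e | inj₁ refl = cong (s0 ∷_) (zo-wt-eq (zo-tail h) e)
zo-wt-eq {a = s0 ∷ a} {sm ∷ b} h e | inj₁ refl = ⊥-elim (<⇒≢ (s≤s (zo-wt (zo-tail h))) e)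
zo-wt-eq {a = s0 ∷ a} {sp ∷ b} h e | inj₁ refl = ⊥-elim (<⇒≢ (s≤s (zo-wt (zo-tail h))) e)

Below : ∀ {n} → SignVec n → SignVec n → Set
Below a b = ZO a b ⊎ ZO (negV a) b

below-trans : ∀ {n} {a b c : SignVec n} → Below a b → Below b c → Below a c
below-trans (inj₁ h) (inj₁ g) = inj₁ (zo-trans h g)
below-trans (inj₁ h) (inj₂ g) = inj₂ (zo-trans (zo-neg h) g)
below-trans (inj₂ h) (inj₁ g) = inj₂ (zo-trans h g)
below-trans {a = a} {b} (inj₂ h) (inj₂ g) = inj₁ (zo-trans (subst (λ v → ZO v (negV b)) (negV-inv a) (zo-neg h)) g)

supp-negV : ∀ {n} (a : SignVec n) i → supp (negV a) i ≡ supp a i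
supp-negV a i = trans (cong isNz (lookup-negV a i)) (isNz-negS _)

below-supp : ∀ {n} {a b : SignVec n} → Below a b → ∀ i → supp a i ≡ true → supp b i ≡ true
below-supp (inj₁ h) i e = zo-supp h i e
below-supp {a = a} (inj₂ h) i e = zo-supp h i (trans (supp-negV a i) e)

-- Elements of PV are determined by their underlying vector (the normalisation proof is
-- a proposition, by uniqueness of identity proofs).
pv-≡ : ∀ {n} {a b : PV n} → proj₁ a ≡ proj₁ b → a ≡ b
pv-≡ {a = ω , p} {.ω , q} refl = cong (ω ,_) (uip p q)

_≟PV_ : ∀ {n} (a b : PV n) → Dec (a ≡ b)
a ≟PV b with ≡-dec _≟S_ (proj₁ a) (proj₁ b)
... | yes e = yes (pv-≡ e)
... | no ne = no (λ e → ne (cong proj₁ e))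

-- var is monotone along P_n: zeroing entries deletes elements from the sequence of
-- nonzero signs, which cannot create sign changes, and negation preserves var.

isMinus : Sign → Bool
isMinus sm = true
isMinus _ = false

changesFrom : Sign → List Sign → ℕ
changesFrom c l = signChanges (c ∷ l)

changes-cons : ∀ a b xs → signChanges (a ∷ b ∷ xs) ≡ ind (isMinus (a · b)) + signChanges (b ∷ xs)
changes-cons sm sm xs = refl
changes-cons sm s0 xs = refl
changes-cons sm sp xs = refl
changes-cons s0 b xs = refl
changes-cons sp sm xs = refl
changes-cons sp s0 xs = refl
changes-cons sp sp xs = refl

NonZeroS : Sign → Set
NonZeroS s = isNz s ≡ true

allNz : ∀ {n} (ω : SignVec n) → All NonZeroS (nonzeros ω)
allNz [] = []
allNz (sm ∷ ω) = refl ∷ allNz ω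
allNz (s0 ∷ ω) = allNz ω
allNz (sp ∷ ω) = refl ∷ allNz ω

zo-sub : ∀ {n} {a b : SignVec n} → ZO a b → nonzeros a ⊆ nonzeros b
zo-sub {a = []} {[]} h = []
zo-sub {a = x ∷ a} {y ∷ b} h with zo-head h | zo-sub (zo-tail h)
zo-sub {a = s0 ∷ a} {sm ∷ b} h | inj₁ refl | r = sm ∷ʳ r
zo-sub {a = s0 ∷ a} {s0 ∷ b} h | inj₁ refl | r = r
zo-sub {a = s0 ∷ a} {sp ∷ b} h | inj₁ refl | r = sp ∷ʳ r
zo-sub {a = sm ∷ a} {y ∷ b} h | inj₂ refl | r = refl ∷ r
zo-sub {a = s0 ∷ a} {y ∷ b} h | inj₂ refl | r = r
zo-sub {a = sp ∷ a} {y ∷ b} h | inj₂ refl | r = refl ∷ r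

byDecision : ∀ {m n} {p : True (m ≤? n)} → m ≤ n
byDecision {p = p} = toWitness p

changes-triangle₁ : ∀ c y z → NonZeroS y → ind (isMinus (c · z)) ≤ ind (isMinus (c · y)) + ind (isMinus (y · z))
changes-triangle₁ sm sm sm e = byDecision
changes-triangle₁ sm sm s0 e = byDecision
changes-triangle₁ sm sm sp e = byDecision
changes-triangle₁ sm sp sm e = byDecision
changes-triangle₁ sm sp s0 e = byDecision
changes-triangle₁ sm sp sp e = byDecision
changes-triangle₁ s0 sm z e = byDecision
changes-triangle₁ s0 sp z e = byDecision
changes-triangle₁ sp sm sm e = byDecision
changes-triangle₁ sp sm s0 e = byDecision
changes-triangle₁ sp sm sp e = byDecision
changes-triangle₁ sp sp sm e = byDecision
changes-triangle₁ sp sp s0 e = byDecision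
changes-triangle₁ sp sp sp e = byDecision
changes-triangle₁ c s0 z ()

changes-triangle : ∀ c y l → NonZeroS y → changesFrom c l ≤ ind (isMinus (c · y)) + changesFrom y l
changes-triangle c y [] e = z≤n
changes-triangle c y (z ∷ l) e rewrite changes-cons c z l | changes-cons y z l =
  ≤-trans (+-monoˡ-≤ (signChanges (z ∷ l)) (changes-triangle₁ c y z e))
          (≤-reflexive (+-assoc (ind (isMinus (c · y))) _ _))

changesFrom-≥ : ∀ y l → signChanges l ≤ changesFrom y l
changesFrom-≥ y [] = z≤n
changesFrom-≥ y (z ∷ l) rewrite changes-cons y z l = m≤n+m _ _

changesFrom-mono : ∀ c {xs ys} → All NonZeroS ys → xs ⊆ ys → changesFrom c xs ≤ changesFrom c ys
changesFrom-mono c a [] = ≤-refl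
changesFrom-mono c {ys = y ∷ ys} (e ∷ a) (.y ∷ʳ s) =
  ≤-trans (changesFrom-mono c a s) (≤-trans (changes-triangle c y ys e) (≤-reflexive (sym (changes-cons c y ys))))
changesFrom-mono c {xs = x ∷ xs} {ys = x ∷ ys} (e ∷ a) (refl ∷ s) =
  ≤-trans (≤-reflexive (changes-cons c x xs))
   (≤-trans (+-monoʳ-≤ (ind (isMinus (c · x))) (changesFrom-mono x a s)) (≤-reflexive (sym (changes-cons c x ys))))

signChanges-mono : ∀ {xs ys} → All NonZeroS ys → xs ⊆ ys → signChanges xs ≤ signChanges ys
signChanges-mono a [] = ≤-refl
signChanges-mono {ys = y ∷ ys} (e ∷ a) (.y ∷ʳ s) = ≤-trans (signChanges-mono a s) (changesFrom-≥ y ys)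
signChanges-mono {x ∷ _} (e ∷ a) (refl ∷ s) = changesFrom-mono x a s

var-mono : ∀ {n} {a b : SignVec n} → ZO a b → var a ≤ var b
var-mono {b = b} h = signChanges-mono (allNz b) (zo-sub h)

nonzeros-neg : ∀ {n} (ω : SignVec n) → nonzeros (negV ω) ≡ L.map negS (nonzeros ω)
nonzeros-neg [] = refl
nonzeros-neg (sm ∷ ω) = cong (sp ∷_) (nonzeros-neg ω)
nonzeros-neg (s0 ∷ ω) = nonzeros-neg ω
nonzeros-neg (sp ∷ ω) = cong (sm ∷_) (nonzeros-neg ω)

signChanges-negS : ∀ l → signChanges (L.map negS l) ≡ signChanges l
signChanges-negS [] = refl
signChanges-negS (a ∷ []) = refl
signChanges-negS (a ∷ b ∷ l) =
  trans (changes-cons (negS a) (negS b) (L.map negS l))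
   (trans (cong₂ _+_ (cong (λ s → ind (isMinus s)) (·-negS a b)) (signChanges-negS (b ∷ l)))
     (sym (changes-cons a b l)))

var-negV : ∀ {n} (ω : SignVec n) → var (negV ω) ≡ var ω
var-negV ω rewrite nonzeros-neg ω = signChanges-negS (nonzeros ω)

below-var : ∀ {n} {a b : SignVec n} → Below a b → var a ≤ var b
below-var (inj₁ h) = var-mono h
below-var {a = a} (inj₂ h) = subst (_≤ _) (var-negV a) (var-mono h)

firstNz-neg : ∀ {n} (ω : SignVec n) → firstNz (toList (negV ω)) ≡ M.map negS (firstNz (toList ω))
firstNz-neg [] = refl
firstNz-neg (sm ∷ ω) = refl
firstNz-neg (s0 ∷ ω) = firstNz-neg ω
firstNz-neg (sp ∷ ω) = refl

firstNz-not0 : ∀ l → firstNz l ≢ just s0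
firstNz-not0 [] ()
firstNz-not0 (sm ∷ l) ()
firstNz-not0 (s0 ∷ l) e = firstNz-not0 l e
firstNz-not0 (sp ∷ l) ()

Rep : ∀ {n} → SignVec n → Set
Rep ω = firstNz (toList ω) ≡ just sp

rep-neg : ∀ {n} (ω : SignVec n) → Rep ω → ¬ Rep (negV ω)
rep-neg ω r e rewrite firstNz-neg ω | r with e
... | ()

unitVec : ∀ k → SignVec (suc k)
unitVec k = sp ∷ zeroVec k

-- normPV r: the representative of the class of r in PV (of ±r, the one starting with
-- +).  The zero vector, which has no class, is sent to an arbitrary element.
normAux : ∀ {k} (r : SignVec (suc k)) (m : Maybe Sign) → firstNz (toList r) ≡ m → PV (suc k)
normAux r (just sp) eq = r , eq
normAux r (just sm) eq = negV r , trans (firstNz-neg r) (cong (M.map negS) eq)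
normAux {k} r (just s0) eq = unitVec k , refl
normAux {k} r nothing eq = unitVec k , refl

normPV : ∀ {k} → SignVec (suc k) → PV (suc k)
normPV r = normAux r (firstNz (toList r)) refl

NonZeroV : ∀ {n} → SignVec n → Set
NonZeroV ω = firstNz (toList ω) ≢ nothing

normAux-prop : ∀ {k} (r : SignVec (suc k)) m eq → NonZeroV r → (proj₁ (normAux r m eq) ≡ r) ⊎ (proj₁ (normAux r m eq) ≡ negV r)
normAux-prop r (just sp) eq nzr = inj₁ refl
normAux-prop r (just sm) eq nzr = inj₂ refl
normAux-prop r (just s0) eq nzr = ⊥-elim (firstNz-not0 (toList r) eq)
normAux-prop r nothing eq nzr = ⊥-elim (nzr eq)

normPV-prop : ∀ {k} (r : SignVec (suc k)) → NonZeroV r → (proj₁ (normPV r) ≡ r) ⊎ (proj₁ (normPV r) ≡ negV r)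
normPV-prop r = normAux-prop r _ refl

nothing≢just : ∀ {s : Sign} → nothing ≢ just s
nothing≢just ()

rep-nz : ∀ {n} (r : SignVec n) → Rep r → NonZeroV r
rep-nz r rr e = nothing≢just (trans (sym e) rr)

normPV-rep : ∀ {k} (r : SignVec (suc k)) → Rep r → proj₁ (normPV r) ≡ r
normPV-rep r rr with normPV-prop r (rep-nz r rr)
... | inj₁ e = e
... | inj₂ e = ⊥-elim (rep-neg r rr (subst Rep e (proj₂ (normPV r))))

filterᵇ : ∀ {A : Set} → (A → Bool) → List A → List A
filterᵇ P xs = L.filter (λ i → P i B.≟ true) xs

filterᵇ-cons : ∀ {A : Set} (P : A → Bool) x xs → filterᵇ P (x ∷ xs) ≡ (if P x then x ∷ filterᵇ P xs else filterᵇ P xs)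
filterᵇ-cons P x xs with P x
... | true = refl
... | false = refl

signedZ : ∀ {n} → (Fin n → Bool) → Fin n → ℤ
signedZ bar j = if bar j then - idxℤ j else idxℤ j

multiplicity : ∀ {A : Set} → List (A → Bool) → A → ℕ
multiplicity [] x = 0
multiplicity (P ∷ Ps) x = ind (P x) + multiplicity Ps x

concatFilter-extract : ∀ {A : Set} (Ps : List (A → Bool)) x xs →
  concat (L.map (λ P → filterᵇ P (x ∷ xs)) Ps) ↭ L.replicate (multiplicity Ps x) x ++ concat (L.map (λ P → filterᵇ P xs) Ps)
concatFilter-extract [] x xs = ↭-refl
concatFilter-extract (P ∷ Ps) x xs rewrite filterᵇ-cons P x xs with P x
... | true = prep x (↭-trans (++⁺ˡ (filterᵇ P xs) (concatFilter-extract Ps x xs)) (shifts (filterᵇ P xs) (L.replicate (multiplicity Ps x) x)))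
... | false = ↭-trans (++⁺ˡ (filterᵇ P xs) (concatFilter-extract Ps x xs)) (shifts (filterᵇ P xs) (L.replicate (multiplicity Ps x) x))

concatFilter-partition : ∀ {A : Set} (xs : List A) (Ps : List (A → Bool)) → All (λ x → multiplicity Ps x ≡ 1) xs →
  concat (L.map (λ P → filterᵇ P xs) Ps) ↭ xs
concatFilter-partition [] Ps a = ↭-reflexive (cz Ps) where
  cz : ∀ {A : Set} (Ps : List (A → Bool)) → concat (L.map (λ P → filterᵇ P []) Ps) ≡ []
  cz [] = refl
  cz (P ∷ Ps) = cz Ps
concatFilter-partition (x ∷ xs) Ps (e ∷ a) = ↭-trans (concatFilter-extract Ps x xs) (helper (multiplicity Ps x) e)
  where
  helper : ∀ c → c ≡ 1 → L.replicate c x ++ concat (L.map (λ P → filterᵇ P xs) Ps) ↭ x ∷ xs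
  helper .1 refl = prep x (concatFilter-partition xs Ps a)

split-signed : ∀ {n} (bar I : Fin n → Bool) (xs : List (Fin n)) →
  L.map (λ i → - idxℤ i) (filterᵇ (λ i → I i ∧ bar i) xs) ++ L.map idxℤ (filterᵇ (λ i → I i ∧ not (bar i)) xs)
  ↭ L.map (signedZ bar) (filterᵇ I xs)
split-signed bar I [] = ↭-refl
split-signed bar I (x ∷ xs)
  rewrite filterᵇ-cons (λ i → I i ∧ bar i) x xs | filterᵇ-cons (λ i → I i ∧ not (bar i)) x xs | filterᵇ-cons I x xs
  with I x | bar x in eb
... | true | true rewrite eb = prep _ (split-signed bar I xs)
... | true | false rewrite eb = ↭-trans (shift (idxℤ x) (L.map (λ i → - idxℤ i) (filterᵇ (λ i → I i ∧ bar i) xs)) _)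
                       (prep _ (split-signed bar I xs))
... | false | true = split-signed bar I xs
... | false | false = split-signed bar I xs

word-↭ : ∀ {n} (bar I : Fin n → Bool) → word bar I ↭ L.map (signedZ bar) (filterᵇ I (allFin n))
word-↭ {n} bar I = ↭-trans (++⁺ʳ _ (map⁺ (λ i → - idxℤ i) (↭-reverse (filterᵇ (λ i → I i ∧ bar i) (allFin n))))) (split-signed bar I (allFin n))

concat-map-↭ : ∀ {A B : Set} (f g : A → List B) → (∀ x → f x ↭ g x) → ∀ xs → concat (L.map f xs) ↭ concat (L.map g xs)
concat-map-↭ f g h [] = ↭-refl
concat-map-↭ f g h (x ∷ xs) = ++⁺ (h x) (concat-map-↭ f g h xs)

map-concat-map : ∀ {A B C : Set} (f : B → C) (g : A → List B) xs → concat (L.map (λ x → L.map f (g x)) xs) ≡ L.map f (concat (L.map g xs))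
map-concat-map f g [] = refl
map-concat-map f g (x ∷ xs) = trans (cong (L.map f (g x) ++_) (map-concat-map f g xs)) (sym (LP.map-++ f (g x) _))

multiplicity-++ : ∀ {A : Set} (Ps Qs : List (A → Bool)) x → multiplicity (Ps ++ Qs) x ≡ multiplicity Ps x + multiplicity Qs x
multiplicity-++ [] Qs x = refl
multiplicity-++ (P ∷ Ps) Qs x = trans (cong (ind (P x) +_) (multiplicity-++ Ps Qs x)) (sym (+-assoc (ind (P x)) _ _))

multiplicity-reverse : ∀ {A : Set} (Ps : List (A → Bool)) x → multiplicity (reverse Ps) x ≡ multiplicity Ps x
multiplicity-reverse [] x = refl
multiplicity-reverse (P ∷ Ps) x = begin
    multiplicity (reverse (P ∷ Ps)) x ≡⟨ cong (λ l → multiplicity l x) (LP.unfold-reverse P Ps) ⟩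
    multiplicity (reverse Ps ++ [ P ]) x ≡⟨ multiplicity-++ (reverse Ps) [ P ] x ⟩
    multiplicity (reverse Ps) x + (ind (P x) + 0) ≡⟨ cong₂ _+_ (multiplicity-reverse Ps x) (+-identityʳ (ind (P x))) ⟩
    multiplicity Ps x + ind (P x) ≡⟨ +-comm (multiplicity Ps x) _ ⟩
    ind (P x) + multiplicity Ps x ∎
  where open ≡-Reasoning

phi-↭ : ∀ {n} (bar : Fin n → Bool) (Qs : List (Fin n → Bool)) → (∀ i → multiplicity Qs i ≡ 1) →
  concat (L.map (word bar) Qs) ↭ L.map (signedZ bar) (allFin n)
phi-↭ {n} bar Qs h =
  ↭-trans (concat-map-↭ _ _ (word-↭ bar) Qs)
   (↭-trans (↭-reflexive (map-concat-map (signedZ bar) (λ I → filterᵇ I (allFin n)) Qs))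
     (map⁺ (signedZ bar) (concatFilter-partition (allFin n) Qs (All.tabulate (λ {x} _ → h x)))))

countList : ∀ {A : Set} → (A → Bool) → List A → ℕ
countList P [] = 0
countList P (x ∷ xs) = ind (P x) + countList P xs

negCount-signed : ∀ {n} (bar : Fin n → Bool) xs → negCount (L.map (signedZ bar) xs) ≡ countList bar xs
negCount-signed bar [] = refl
negCount-signed bar (x ∷ xs) with bar x
... | true = cong suc (negCount-signed bar xs)
... | false = negCount-signed bar xs

abs-signed : ∀ {n} (bar : Fin n → Bool) xs → L.map ∣_∣ (L.map (signedZ bar) xs) ≡ L.map (λ i → suc (toℕ i)) xs
abs-signed bar [] = refl
abs-signed bar (x ∷ xs) with bar x
... | true = cong (suc (toℕ x) ∷_) (abs-signed bar xs)
... | false = cong (suc (toℕ x) ∷_) (abs-signed bar xs)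

tab-upTo : ∀ n (g : ℕ → ℕ) → tabulate {n = n} (λ i → g (toℕ i)) ≡ applyUpTo g n
tab-upTo zero g = refl
tab-upTo (suc n) g = cong (g 0 ∷_) (tab-upTo n (λ m → g (suc m)))

allFin-upTo : ∀ n → L.map (λ i → suc (toℕ i)) (allFin n) ≡ applyUpTo suc n
allFin-upTo n = trans (LP.map-tabulate (λ i → i) (λ i → suc (toℕ i))) (tab-upTo n suc)

signedPerm : ∀ {n} (bar : Fin n → Bool) π → π ↭ L.map (signedZ bar) (allFin n) → IsSignedPerm n π
signedPerm {n} bar π p = ↭-trans (map⁺ ∣_∣ p) (↭-reflexive (trans (abs-signed bar (allFin n)) (allFin-upTo n)))

negCount-↭ : ∀ {xs ys} → xs ↭ ys → negCount xs ≡ negCount ys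
negCount-↭ p = ↭-length (filter-↭ (λ z → ZP._<?_ z (Z.+ 0)) p)

-- We first describe the cyclic backward scan of Defs concretely:
-- looking backwards from i, one sees ω_{i-1}, …, ω_0 and then ω_{n-1}, …, ω_i.  Hence i
-- is a flip iff ω_i opposes the last nonzero entry before it, or, when there is none, the
-- last nonzero entry of ω (inBAR-char).  Counting flips then yields the number of sign
-- changes of the cyclic sequence of nonzero entries, which is even and at most var + 1.

-- lookupℕ: lookup with a natural-number index (zero when out of range).
lookupℕ : ∀ {n} → SignVec n → ℕ → Sign
lookupℕ [] t = s0
lookupℕ (x ∷ v) zero = x
lookupℕ (x ∷ v) (suc t) = lookupℕ v t

lookup-ℕ : ∀ {n} (ω : SignVec n) (f : Fin n) → lookup ω f ≡ lookupℕ ω (toℕ f)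
lookup-ℕ (x ∷ ω) zero = refl
lookup-ℕ (x ∷ ω) (suc f) = lookup-ℕ ω f

range : ℕ → ℕ → List ℕ
range s zero = []
range s (suc c) = s ∷ range (suc s) c

down : ℕ → List ℕ
down zero = []
down (suc c) = c ∷ down c

search : List Sign → Sign → Bool
search [] x = false
search (s ∷ ss) x with s · x
... | sm = true
... | s0 = search ss x
... | sp = false

flip-search : ∀ {k} (ω : SignVec (suc k)) i j b → isFlipFrom ω i j b ≡ search (L.map (cycBack ω i) (range j b)) (lookup ω i)
flip-search ω i j zero = refl
flip-search ω i j (suc b) with cycBack ω i j · lookup ω i
... | sm = refl
... | s0 = flip-search ω i (suc j) b
... | sp = refl

opposes : Maybe Sign → Sign → Bool
opposes (just s) x = isMinus (s · x)
opposes nothing x = false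

search-s0 : ∀ ss → search ss s0 ≡ false
search-s0 [] = refl
search-s0 (sm ∷ ss) = search-s0 ss
search-s0 (s0 ∷ ss) = search-s0 ss
search-s0 (sp ∷ ss) = search-s0 ss

search-opposes : ∀ ss x → search ss x ≡ opposes (firstNz ss) x
search-opposes [] x = refl
search-opposes (s0 ∷ ss) x = search-opposes ss x
search-opposes (sm ∷ ss) sm = refl
search-opposes (sm ∷ ss) s0 = search-s0 ss
search-opposes (sm ∷ ss) sp = refl
search-opposes (sp ∷ ss) sm = refl
search-opposes (sp ∷ ss) s0 = search-s0 ss
search-opposes (sp ∷ ss) sp = refl

firstNz-++ : ∀ A B → firstNz (A ++ B) ≡ (firstNz A <∣> firstNz B)
firstNz-++ [] B = refl
firstNz-++ (sm ∷ A) B = refl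
firstNz-++ (s0 ∷ A) B = firstNz-++ A B
firstNz-++ (sp ∷ A) B = refl

lastNz : List Sign → Maybe Sign
lastNz l = firstNz (reverse l)

-- Modular arithmetic for the cyclic index i - j, computed as i + j(n - 1) mod n: for
-- j ≤ i it is i - j, and for i < j ≤ n it is n + i - j.
before-index-eq : ∀ t e k → suc t + e + suc t * k ≡ e + suc t * suc k
before-index-eq = solve-∀

mod-before : ∀ k t e → suc t + e < suc k → (suc t + e + suc t * k) % suc k ≡ e
mod-before k t e lt = trans (cong (_% suc k) (before-index-eq t e k))
  (trans ([m+kn]%n≡m%n e (suc t) (suc k)) (m<n⇒m%n≡m (≤-trans (s≤s (≤-trans (m≤n+m e t) (n≤1+n _))) lt)))

after-index-eq : ∀ a d p → a + suc (a + d) * (p + d) ≡ p + (a + d) * suc (p + d)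
after-index-eq = solve-∀

mod-after : ∀ a d p → (a + suc (a + d) * (p + d)) % suc (p + d) ≡ p
mod-after a d p = trans (cong (_% suc (p + d)) (after-index-eq a d p))
  (trans ([m+kn]%n≡m%n p (a + d) (suc (p + d))) (m<n⇒m%n≡m (s≤s (m≤m+n p d))))

map-range-cong : ∀ {A : Set} (f : ℕ → A) (h : ℕ → A) s c → (∀ t → t < c → f (s + t) ≡ h t) → L.map f (range s c) ≡ L.map h (range 0 c)
map-range-cong f h s zero H = refl
map-range-cong f h s (suc c) H =
  cong₂ _∷_ (trans (cong f (sym (+-identityʳ s))) (H 0 (s≤s z≤n)))
    (trans (map-range-cong f (λ t → h (suc t)) (suc s) c (λ t lt → trans (cong f (sym (+-suc s t))) (H (suc t) (s≤s lt))))
           (sym (map-range-cong h (λ t → h (suc t)) 1 c (λ t lt → refl))))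

down-as : ∀ {A : Set} (h : ℕ → A) c → L.map h (down c) ≡ L.map (λ t → h (c ∸ suc t)) (range 0 c)
down-as h zero = refl
down-as h (suc c) = cong (h c ∷_) (trans (down-as h c) (sym (map-range-cong (λ t → h (c ∸ t)) (λ t → h (c ∸ suc t)) 1 c (λ t lt → refl))))

range-++ : ∀ s p q → range s (p + q) ≡ range s p ++ range (s + p) q
range-++ s zero q = cong (λ x → range x q) (sym (+-identityʳ s))
range-++ s (suc p) q = cong (s ∷_) (trans (range-++ (suc s) p q) (cong (λ x → range (suc s) p ++ range x q) (sym (+-suc s p))))

range-snoc : ∀ s c → range s (suc c) ≡ range s c ++ [ s + c ]
range-snoc s c = trans (cong (range s) (+-comm 1 c)) (trans (range-++ s c 1) refl)

rev-range : ∀ s c → reverse (range s c) ≡ L.map (s +_) (down c)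
rev-range s zero = refl
rev-range s (suc c) = begin
  reverse (range s (suc c)) ≡⟨ cong reverse (range-snoc s c) ⟩
  reverse (range s c ++ [ s + c ]) ≡⟨ LP.reverse-++ (range s c) [ s + c ] ⟩
  (s + c) ∷ reverse (range s c) ≡⟨ cong ((s + c) ∷_) (rev-range s c) ⟩
  L.map (s +_) (down (suc c)) ∎
  where open ≡-Reasoning

map-down : ∀ {A : Set} (g : ℕ → A) c → L.map g (down c) ≡ reverse (L.map g (range 0 c))
map-down g c = begin
  L.map g (down c) ≡⟨ cong (L.map g) (sym (LP.map-id (down c))) ⟩
  L.map g (L.map (0 +_) (down c)) ≡⟨ cong (L.map g) (sym (rev-range 0 c)) ⟩
  L.map g (reverse (range 0 c)) ≡⟨ LP.reverse-map g (range 0 c) ⟩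
  reverse (L.map g (range 0 c)) ∎
  where open ≡-Reasoning

map-down+ : ∀ {A : Set} (g : ℕ → A) a c → L.map (λ t → g (a + t)) (down c) ≡ reverse (L.map g (range a c))
map-down+ g a c = begin
  L.map (λ t → g (a + t)) (down c) ≡⟨ LP.map-∘ (down c) ⟩
  L.map g (L.map (a +_) (down c)) ≡⟨ cong (L.map g) (sym (rev-range a c)) ⟩
  L.map g (reverse (range a c)) ≡⟨ LP.reverse-map g (range a c) ⟩
  reverse (L.map g (range a c)) ∎
  where open ≡-Reasoning

cycBack-ℕ : ∀ {k} (ω : SignVec (suc k)) i j → cycBack ω i j ≡ lookupℕ ω ((toℕ i + j * k) % suc k)
cycBack-ℕ {k} ω i j = trans (lookup-ℕ ω _) (cong (lookupℕ ω) (toℕ-fromℕ< (m%n<n (toℕ i + j * k) (suc k))))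

split-< : ∀ {t c} → t < c → ∃ λ e → c ≡ suc t + e
split-< {zero} {suc c} (s≤s lt) = c , refl
split-< {suc t} {suc c} (s≤s lt) with split-< lt
... | e , refl = e , refl

cycBack-before : ∀ {k} (ω : SignVec (suc k)) i → L.map (cycBack ω i) (range 1 (toℕ i))
         ≡ L.map (λ t → lookupℕ ω (toℕ i ∸ suc t)) (range 0 (toℕ i))
cycBack-before {k} ω i = map-range-cong (cycBack ω i) _ 1 (toℕ i) H
  where
  H : ∀ t → t < toℕ i → cycBack ω i (suc t) ≡ lookupℕ ω (toℕ i ∸ suc t)
  H t lt with split-< lt
  ... | e , eq = trans (cycBack-ℕ ω i (suc t)) (cong (lookupℕ ω)
        (trans (cong (λ a → (a + suc t * k) % suc k) eq)
          (trans (mod-before k t e (subst (_< suc k) eq (toℕ<n i))) (sym (subst (λ a → a ∸ suc t ≡ e) (sym eq) (m+n∸m≡n (suc t) e))))))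

split-index-eq : ∀ a t e → a + suc (t + e) ≡ suc ((a + e) + t)
split-index-eq = solve-∀

cycBack-after : ∀ {k} (ω : SignVec (suc k)) i b → toℕ i + b ≡ suc k → L.map (cycBack ω i) (range (suc (toℕ i)) b)
         ≡ L.map (λ t → lookupℕ ω (toℕ i + (b ∸ suc t))) (range 0 b)
cycBack-after {k} ω i b ab = map-range-cong (cycBack ω i) _ (suc (toℕ i)) b H
  where
  a = toℕ i
  H : ∀ t → t < b → cycBack ω i (suc a + t) ≡ lookupℕ ω (a + (b ∸ suc t))
  H t lt with split-< lt
  ... | e , refl = trans (cycBack-ℕ ω i (suc a + t)) (cong (lookupℕ ω) (trans step (cong (a +_) (sym (m+n∸m≡n (suc t) e)))))
    where
    keq : k ≡ (a + e) + t
    keq = suc-injective (trans (sym ab) (split-index-eq a t e))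
    step : (a + suc (a + t) * k) % suc k ≡ a + e
    step = subst (λ K → (a + suc (a + t) * K) % suc K ≡ a + e) (sym keq) (mod-after a t (a + e))

cycBack-list : ∀ {k} (ω : SignVec (suc k)) i →
  L.map (cycBack ω i) (range 1 (suc k)) ≡
  reverse (L.map (lookupℕ ω) (range 0 (toℕ i))) ++ reverse (L.map (lookupℕ ω) (range (toℕ i) (suc k ∸ toℕ i)))
cycBack-list {k} ω i = begin
  L.map (cycBack ω i) (range 1 (suc k)) ≡⟨ cong (λ c → L.map (cycBack ω i) (range 1 c)) (sym ab) ⟩
  L.map (cycBack ω i) (range 1 (a + b)) ≡⟨ cong (L.map (cycBack ω i)) (range-++ 1 a b) ⟩
  L.map (cycBack ω i) (range 1 a ++ range (suc a) b) ≡⟨ LP.map-++ (cycBack ω i) (range 1 a) _ ⟩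
  L.map (cycBack ω i) (range 1 a) ++ L.map (cycBack ω i) (range (suc a) b) ≡⟨ cong₂ _++_ (cycBack-before ω i) (cycBack-after ω i b ab) ⟩
  L.map (λ t → g (a ∸ suc t)) (range 0 a) ++ L.map (λ t → g (a + (b ∸ suc t))) (range 0 b)
    ≡⟨ cong₂ _++_ (sym (down-as g a)) (sym (down-as (λ t → g (a + t)) b)) ⟩
  L.map g (down a) ++ L.map (λ t → g (a + t)) (down b) ≡⟨ cong₂ _++_ (map-down g a) (map-down+ g a b) ⟩
  reverse (L.map g (range 0 a)) ++ reverse (L.map g (range a b)) ∎
  where
  open ≡-Reasoning
  a = toℕ i
  b = suc k ∸ toℕ i
  g = lookupℕ ω
  ab : a + b ≡ suc k
  ab = m+[n∸m]≡n (<⇒≤ (toℕ<n i))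

prefix : ∀ {n} → SignVec n → ℕ → List Sign
prefix ω a = L.map (lookupℕ ω) (range 0 a)

inBAR-char : ∀ {k} (ω : SignVec (suc k)) i →
  inBAR ω i ≡ opposes (lastNz (prefix ω (toℕ i)) <∣> lastNz (prefix ω (suc k))) (lookup ω i)
inBAR-char {k} ω i = begin
  isFlipFrom ω i 1 (suc k) ≡⟨ flip-search ω i 1 (suc k) ⟩
  search (L.map (cycBack ω i) (range 1 (suc k))) x ≡⟨ cong (λ l → search l x) (cycBack-list ω i) ⟩
  search (reverse A ++ reverse B) x ≡⟨ search-opposes (reverse A ++ reverse B) x ⟩
  opposes (firstNz (reverse A ++ reverse B)) x ≡⟨ cong (λ m → opposes m x) (firstNz-++ (reverse A) (reverse B)) ⟩
  opposes (lastNz A <∣> lastNz B) x ≡⟨ cong (λ m → opposes m x) (lem (lastNz A) refl) ⟩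
  opposes (lastNz A <∣> lastNz (prefix ω (suc k))) x ∎
  where
  open ≡-Reasoning
  x = lookup ω i
  a = toℕ i
  b = suc k ∸ toℕ i
  A = prefix ω a
  B = L.map (lookupℕ ω) (range a b)
  ab : a + b ≡ suc k
  ab = m+[n∸m]≡n (<⇒≤ (toℕ<n i))
  preEq : prefix ω (suc k) ≡ A ++ B
  preEq = trans (cong (prefix ω) (sym ab)) (trans (cong (L.map (lookupℕ ω)) (range-++ 0 a b)) (LP.map-++ (lookupℕ ω) (range 0 a) _))
  lastEq : lastNz (prefix ω (suc k)) ≡ (lastNz B <∣> lastNz A)
  lastEq = trans (cong lastNz preEq) (trans (cong firstNz (LP.reverse-++ A B)) (firstNz-++ (reverse B) (reverse A)))
  lem : ∀ m → lastNz A ≡ m → (m <∣> lastNz B) ≡ (m <∣> lastNz (prefix ω (suc k)))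
  lem (just s) e = refl
  lem nothing e = sym (trans lastEq (trans (cong (lastNz B <∣>_) e) (<∣>-identityʳ (lastNz B))))

prefix-cons : ∀ {m} x (v : SignVec m) a → prefix (x ∷ v) (suc a) ≡ x ∷ prefix v a
prefix-cons x v a = cong (x ∷_) (map-range-cong (lookupℕ (x ∷ v)) (lookupℕ v) 1 a (λ t lt → refl))

prefix-full : ∀ {m} (v : SignVec m) → prefix v m ≡ toList v
prefix-full [] = refl
prefix-full (x ∷ v) = trans (prefix-cons x v _) (cong (x ∷_) (prefix-full v))

pushSign : Maybe Sign → Sign → Maybe Sign
pushSign pm sm = just sm
pushSign pm s0 = pm
pushSign pm sp = just sp

lastNz-snoc : ∀ P y → lastNz (P ++ [ y ]) ≡ pushSign (lastNz P) y
lastNz-snoc P y rewrite LP.reverse-++ P [ y ] with y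
... | sm = refl
... | s0 = refl
... | sp = refl

prefixFlips : Maybe Sign → Maybe Sign → List Sign → ℕ
prefixFlips pm L [] = 0
prefixFlips pm L (y ∷ ys) = ind (opposes (pm <∣> L) y) + prefixFlips (pushSign pm y) L ys

countFin-prefix : ∀ {m} (P : List Sign) (v : SignVec m) L →
  countFin (λ i → opposes (lastNz (P ++ prefix v (toℕ i)) <∣> L) (lookup v i)) ≡ prefixFlips (lastNz P) L (toList v)
countFin-prefix P [] L = refl
countFin-prefix P (x ∷ v) L = cong₂ _+_ (cong (λ l → ind (opposes (lastNz l <∣> L) x)) (LP.++-identityʳ P))
  (trans (countFin-cong (λ i → cong (λ l → opposes (lastNz l <∣> L) (lookup v i))
                        (trans (cong (P ++_) (prefix-cons x v (toℕ i))) (sym (LP.++-assoc P [ x ] (prefix v (toℕ i)))))))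
    (trans (countFin-prefix (P ++ [ x ]) v L) (cong (λ m → prefixFlips m L (toList v)) (lastNz-snoc P x))))

flipsAfter : Maybe Sign → Maybe Sign → List Sign → ℕ
flipsAfter pm L [] = 0
flipsAfter pm L (y ∷ ys) = ind (opposes (pm <∣> L) y) + flipsAfter (just y) L ys

opposes-s0 : ∀ m → opposes m s0 ≡ false
opposes-s0 (just sm) = refl
opposes-s0 (just s0) = refl
opposes-s0 (just sp) = refl
opposes-s0 nothing = refl

-- Zero entries never contribute, so the scan may be run on the nonzero entries only.
prefixFlips-nonzeros : ∀ {m} pm L (v : SignVec m) → prefixFlips pm L (toList v) ≡ flipsAfter pm L (nonzeros v)
prefixFlips-nonzeros pm L [] = refl
prefixFlips-nonzeros pm L (sm ∷ v) = cong (ind (opposes (pm <∣> L) sm) +_) (prefixFlips-nonzeros (just sm) L v)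
prefixFlips-nonzeros pm L (s0 ∷ v) = trans (cong (λ b → ind b + prefixFlips pm L (toList v)) (opposes-s0 (pm <∣> L))) (prefixFlips-nonzeros pm L v)
prefixFlips-nonzeros pm L (sp ∷ v) = cong (ind (opposes (pm <∣> L) sp) +_) (prefixFlips-nonzeros (just sp) L v)

flipsAfter-just : ∀ p L l → flipsAfter (just p) L l ≡ signChanges (p ∷ l)
flipsAfter-just p L [] = refl
flipsAfter-just p L (y ∷ ys) = trans (cong (ind (isMinus (p · y)) +_) (flipsAfter-just y L ys)) (sym (changes-cons p y ys))

lastNz-cons : ∀ x l → lastNz (x ∷ l) ≡ (lastNz l <∣> firstNz [ x ])
lastNz-cons x l = trans (cong firstNz (LP.unfold-reverse x l)) (firstNz-++ (reverse l) [ x ])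

lastNz-nz : ∀ {m} (v : SignVec m) → lastNz (toList v) ≡ lastNz (nonzeros v)
lastNz-nz [] = refl
lastNz-nz (sm ∷ v) = trans (lastNz-cons sm (toList v)) (trans (cong (_<∣> just sm) (lastNz-nz v)) (sym (lastNz-cons sm (nonzeros v))))
lastNz-nz (s0 ∷ v) = trans (lastNz-cons s0 (toList v)) (trans (<∣>-identityʳ _) (lastNz-nz v))
lastNz-nz (sp ∷ v) = trans (lastNz-cons sp (toList v)) (trans (cong (_<∣> just sp) (lastNz-nz v)) (sym (lastNz-cons sp (nonzeros v))))

lastOf : Sign → List Sign → Sign
lastOf y [] = y
lastOf y (z ∷ zs) = lastOf z zs

lastNz-lastOf : ∀ y ys → All NonZeroS (y ∷ ys) → lastNz (y ∷ ys) ≡ just (lastOf y ys)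
lastNz-lastOf y [] (e ∷ []) = trans (lastNz-cons y []) (fn y e)
  where fn : ∀ y → NonZeroS y → (nothing <∣> firstNz [ y ]) ≡ just y
        fn sm e = refl
        fn sp e = refl
lastNz-lastOf y (z ∷ zs) (e ∷ a) = trans (lastNz-cons y (z ∷ zs)) (cong (_<∣> firstNz [ y ]) (lastNz-lastOf z zs a))

lastOf-nonzero : ∀ y ys → All NonZeroS (y ∷ ys) → NonZeroS (lastOf y ys)
lastOf-nonzero y [] (e ∷ []) = e
lastOf-nonzero y (z ∷ zs) (e ∷ a) = lastOf-nonzero z zs a

countBAR : ∀ {k} (ω : SignVec (suc k)) → countFin (inBAR ω) ≡ flipsAfter nothing (lastNz (nonzeros ω)) (nonzeros ω)
countBAR {k} ω = begin
  countFin (inBAR ω) ≡⟨ countFin-cong (inBAR-char ω) ⟩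
  countFin (λ i → opposes (lastNz ([] ++ prefix ω (toℕ i)) <∣> L) (lookup ω i)) ≡⟨ countFin-prefix [] ω L ⟩
  prefixFlips nothing L (toList ω) ≡⟨ prefixFlips-nonzeros nothing L ω ⟩
  flipsAfter nothing L (nonzeros ω) ≡⟨ cong (λ m → flipsAfter nothing m (nonzeros ω)) (trans (cong lastNz (prefix-full ω)) (lastNz-nz ω)) ⟩
  flipsAfter nothing (lastNz (nonzeros ω)) (nonzeros ω) ∎
  where
  open ≡-Reasoning
  L = lastNz (prefix ω (suc k))

odd : ℕ → Bool
odd zero = false
odd (suc n) = not (odd n)

odd-+ : ∀ m n → odd (m + n) ≡ odd m xor odd n
odd-+ zero n = refl
odd-+ (suc m) n rewrite odd-+ m n with odd m | odd n
... | true | true = refl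
... | true | false = refl
... | false | true = refl
... | false | false = refl

odd-ind : ∀ b → odd (ind b) ≡ b
odd-ind true = refl
odd-ind false = refl

sign-triangle : ∀ y z w → NonZeroS y → NonZeroS z → NonZeroS w → (isMinus (y · z) xor isMinus (z · w)) ≡ isMinus (y · w)
sign-triangle sm sm sm _ _ _ = refl
sign-triangle sm sm sp _ _ _ = refl
sign-triangle sm sp sm _ _ _ = refl
sign-triangle sm sp sp _ _ _ = refl
sign-triangle sp sm sm _ _ _ = refl
sign-triangle sp sm sp _ _ _ = refl
sign-triangle sp sp sm _ _ _ = refl
sign-triangle sp sp sp _ _ _ = refl
sign-triangle s0 z w () _ _
sign-triangle sm s0 w _ () _
sign-triangle sp s0 w _ () _
sign-triangle sm sm s0 _ _ ()
sign-triangle sm sp s0 _ _ ()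
sign-triangle sp sm s0 _ _ ()
sign-triangle sp sp s0 _ _ ()

sign-square : ∀ y → NonZeroS y → isMinus (y · y) ≡ false
sign-square sm e = refl
sign-square sp e = refl

odd-signChanges : ∀ y ys → All NonZeroS (y ∷ ys) → odd (signChanges (y ∷ ys)) ≡ isMinus (y · lastOf y ys)
odd-signChanges y [] (e ∷ []) = sym (sign-square y e)
odd-signChanges y (z ∷ zs) (e ∷ a@(e' ∷ a')) = begin
  odd (signChanges (y ∷ z ∷ zs)) ≡⟨ cong odd (changes-cons y z zs) ⟩
  odd (ind (isMinus (y · z)) + signChanges (z ∷ zs)) ≡⟨ odd-+ (ind (isMinus (y · z))) _ ⟩
  odd (ind (isMinus (y · z))) xor odd (signChanges (z ∷ zs)) ≡⟨ cong₂ _xor_ (odd-ind (isMinus (y · z))) (odd-signChanges z zs a) ⟩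
  isMinus (y · z) xor isMinus (z · lastOf z zs) ≡⟨ sign-triangle y z (lastOf z zs) e e' (lastOf-nonzero z zs a) ⟩
  isMinus (y · lastOf z zs) ∎
  where open ≡-Reasoning

·-comm : ∀ a b → a · b ≡ b · a
·-comm sm sm = refl
·-comm sm s0 = refl
·-comm sm sp = refl
·-comm s0 sm = refl
·-comm s0 s0 = refl
·-comm s0 sp = refl
·-comm sp sm = refl
·-comm sp s0 = refl
·-comm sp sp = refl

¬odd⇒even : ∀ n → odd n ≡ false → 2 ∣ n
¬odd⇒even zero e = divides 0 refl
¬odd⇒even (suc zero) ()
¬odd⇒even (suc (suc n)) e with ¬odd⇒even n (trans (sym (not-involutive (odd n))) e)
... | divides q eq = divides (suc q) (cong (λ x → suc (suc x)) eq)

-- cyclicChanges l: the number of sign changes of l read cyclically.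
cyclicChanges : List Sign → ℕ
cyclicChanges l = flipsAfter nothing (lastNz l) l

cyclicChanges-cons : ∀ y ys → All NonZeroS (y ∷ ys) → cyclicChanges (y ∷ ys) ≡ ind (isMinus (lastOf y ys · y)) + signChanges (y ∷ ys)
cyclicChanges-cons y ys a rewrite lastNz-lastOf y ys a = cong (ind (isMinus (lastOf y ys · y)) +_) (flipsAfter-just y (just (lastOf y ys)) ys)

cyclicChanges-even : ∀ l → All NonZeroS l → odd (cyclicChanges l) ≡ false
cyclicChanges-even [] a = refl
cyclicChanges-even (y ∷ ys) a rewrite cyclicChanges-cons y ys a | odd-+ (ind (isMinus (lastOf y ys · y))) (signChanges (y ∷ ys))
  | odd-ind (isMinus (lastOf y ys · y)) | odd-signChanges y ys a | ·-comm (lastOf y ys) y = xor-same (isMinus (y · lastOf y ys))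

cyclicChanges-≤ : ∀ l → All NonZeroS l → cyclicChanges l ≤ suc (signChanges l)
cyclicChanges-≤ [] a = z≤n
cyclicChanges-≤ (y ∷ ys) a rewrite cyclicChanges-cons y ys a = +-monoˡ-≤ (signChanges (y ∷ ys)) (ind≤1 (isMinus (lastOf y ys · y)))

bar-even : ∀ {k} (ω : SignVec (suc k)) → 2 ∣ countFin (inBAR ω)
bar-even ω = ¬odd⇒even _ (trans (cong odd (countBAR ω)) (cyclicChanges-even (nonzeros ω) (allNz ω)))

bar-bound : ∀ {k} (ω : SignVec (suc k)) → countFin (inBAR ω) ≤ suc (var ω)
bar-bound ω = subst (_≤ suc (var ω)) (sym (countBAR ω)) (cyclicChanges-≤ (nonzeros ω) (allNz ω))

even⇒¬odd : ∀ n → 2 ∣ n → odd n ≡ false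
even⇒¬odd n (divides q refl) = lem q
  where
  lem : ∀ q → odd (q * 2) ≡ false
  lem zero = refl
  lem (suc q) = trans (cong not (cong not (lem q))) refl

even-le : ∀ a m → 2 ∣ a → 2 ∣ m → a ≤ suc m → a ≤ m
even-le a m ea em le with a ≟ suc m
... | no ne = m<1+n⇒m≤n (≤∧≢⇒< le ne)
... | yes refl = ⊥-elim (contra (even⇒¬odd m em) (even⇒¬odd (suc m) ea))
  where
  contra : ∀ {b} → b ≡ false → not b ≡ false → ⊥
  contra {true} () _
  contra {false} _ ()

-- Supports of the chain: Φ only depends on the supports ω⁽¹⁾ ⊆ ⋯ ⊆ ω⁽ʳ⁾ (through the
-- blocks I_s) and on the top element (through BAR).

SupportIncl : ∀ {n} → SignVec n → SignVec n → Set
SupportIncl {n} a b = ∀ (i : Fin n) → supp a i ≡ true → supp b i ≡ true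

SupportChain : ∀ {n} → SignVec n → List (SignVec n) → Set
SupportChain prev [] = ⊤
SupportChain prev (w ∷ ws) = SupportIncl prev w × SupportChain w ws

topFrom : ∀ {n} → SignVec n → List (SignVec n) → SignVec n
topFrom prev [] = prev
topFrom prev (w ∷ ws) = topFrom w ws

last-top : ∀ {n} (w : SignVec n) ws → last (w ∷ ws) ≡ just (topFrom w ws)
last-top w [] = refl
last-top w (v ∷ ws) = last-top v ws

topOf-eq : ∀ {n} (ws : List (SignVec n)) → topOf ws ≡ topFrom (zeroVec n) ws
topOf-eq [] = refl
topOf-eq (w ∷ ws) rewrite last-top w ws = refl

blocks-cnt : ∀ {n} (prev : SignVec n) ws → SupportChain prev ws → ∀ i →
  multiplicity (blocks prev ws) i + ind (not (supp (topFrom prev ws) i)) ≡ ind (not (supp prev i))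
blocks-cnt prev [] m i = refl
blocks-cnt prev (w ∷ ws) (inc , m) i =
  trans (+-assoc (ind (supp w i ∧ not (supp prev i))) _ _)
   (trans (cong (ind (supp w i ∧ not (supp prev i)) +_) (blocks-cnt w ws m i)) (fin (supp prev i) (supp w i) (inc i)))
  where
  fin : ∀ a b → (a ≡ true → b ≡ true) → ind (b ∧ not a) + ind (not b) ≡ ind (not a)
  fin true true h = refl
  fin true false h with h refl
  ... | ()
  fin false true h = refl
  fin false false h = refl

Φv-↭ : ∀ {n} (ws : List (SignVec n)) → SupportChain (zeroVec n) ws →
  Φv ws ↭ L.map (signedZ (inBAR (topOf ws))) (allFin n)
Φv-↭ {n} ws m = phi-↭ (inBAR (topOf ws)) Qs cQ
  where
  top = topOf ws
  Qs = reverse (blocks (zeroVec n) ws ++ ((λ i → not (isNz (lookup top i))) ∷ []))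
  cQ : ∀ i → multiplicity Qs i ≡ 1
  cQ i = begin
    multiplicity Qs i ≡⟨ multiplicity-reverse (blocks (zeroVec n) ws ++ _) i ⟩
    multiplicity (blocks (zeroVec n) ws ++ _) i ≡⟨ multiplicity-++ (blocks (zeroVec n) ws) _ i ⟩
    multiplicity (blocks (zeroVec n) ws) i + (ind (not (supp top i)) + 0) ≡⟨ cong (λ t → multiplicity (blocks (zeroVec n) ws) i + (ind (not (supp t i)) + 0)) (topOf-eq ws) ⟩
    multiplicity (blocks (zeroVec n) ws) i + (ind (not (supp (topFrom (zeroVec n) ws) i)) + 0) ≡⟨ cong (multiplicity (blocks (zeroVec n) ws) i +_) (+-identityʳ _) ⟩
    multiplicity (blocks (zeroVec n) ws) i + ind (not (supp (topFrom (zeroVec n) ws) i)) ≡⟨ blocks-cnt (zeroVec n) ws m i ⟩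
    ind (not (supp (zeroVec n) i)) ≡⟨ cong (λ s → ind (not (isNz s))) (lookup-zero n i) ⟩
    1 ∎
    where open ≡-Reasoning

ltP-inc : ∀ {n} {a b : PV n} → a <P b → SupportIncl (proj₁ a) (proj₁ b)
ltP-inc {a = a} {b} (inj₁ h , _) = below-supp {a = proj₁ a} {proj₁ b} (inj₁ (zo h))
ltP-inc {a = a} {b} (inj₂ h , _) = below-supp {a = proj₁ a} {proj₁ b} (inj₂ (zo h))

zero-inc : ∀ {n} (b : SignVec n) → SupportIncl (zeroVec n) b
zero-inc {n} b i e rewrite lookup-zero n i = ⊥-elim (false≢true e)

chain-mono' : ∀ {n} (c : PV n) (C : List (PV n)) → Linked _<P_ (c ∷ C) → SupportChain (proj₁ c) (L.map proj₁ C)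
chain-mono' c [] l = tt
chain-mono' c (d ∷ C) (r ∷ l) = ltP-inc {a = c} {d} r , chain-mono' d C l

chain-mono : ∀ {n} (C : List (PV n)) → Linked _<P_ C → SupportChain (zeroVec n) (L.map proj₁ C)
chain-mono [] l = tt
chain-mono (c ∷ C) l = zero-inc (proj₁ c) , chain-mono' c C l

countList-allFin : ∀ {n} (P : Fin n → Bool) → countList P (allFin n) ≡ countFin P
countList-allFin {zero} P = refl
countList-allFin {suc n} P = cong (ind (P zero) +_) (trans (cong (countList P) (LP.tabulate-cong {f = suc} {g = λ i → suc i} (λ i → refl))) (tl P))
  where
  tl : ∀ {n} (P : Fin (suc n) → Bool) → countList P (tabulate suc) ≡ countFin (λ i → P (suc i))
  tl {n} P = trans (cong (countList P) (sym (LP.map-tabulate (λ i → i) suc))) (trans (cb (allFin n)) (countList-allFin (λ i → P (suc i))))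
    where
    cb : ∀ xs → countList P (L.map suc xs) ≡ countList (λ i → P (suc i)) xs
    cb [] = refl
    cb (x ∷ xs) = cong (ind (P (suc x)) +_) (cb xs)

topInP : ∀ {n} m (C : List (PV n)) → All (InP m) C → var (topOf (L.map proj₁ C)) ≤ m
topInP {n} m [] a = subst (_≤ m) (sym (cong signChanges (nzz n))) z≤n
  where nzz : ∀ n → nonzeros (zeroVec n) ≡ []
        nzz zero = refl
        nzz (suc n) = nzz n
topInP {n} m (c ∷ C) a = subst (λ t → var t ≤ m) (sym (topOf-eq (L.map proj₁ (c ∷ C)))) (go c C a)
  where
  go : ∀ c C → All (InP m) (c ∷ C) → var (topFrom (proj₁ c) (L.map proj₁ C)) ≤ m
  go c [] (x ∷ []) = x
  go c (d ∷ C) (x ∷ a) = go d C a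

negCount-Φ : ∀ {k} (C : List (PV (suc k))) → Linked _<P_ C → negCount (Φ C) ≡ countFin (inBAR (topOf (L.map proj₁ C)))
negCount-Φ {k} C l = trans (negCount-↭ (Φv-↭ (L.map proj₁ C) (chain-mono C l)))
  (trans (negCount-signed bar (allFin (suc k))) (countList-allFin bar))
  where bar = inBAR (topOf (L.map proj₁ C))

face-SD : ∀ {k} m (C : List (PV (suc k))) → IsFace m C → InSD (suc k) (Φ C)
face-SD m C (a , l) = signedPerm _ (Φ C) (Φv-↭ (L.map proj₁ C) (chain-mono C l)) ,
  subst (2 ∣_) (sym (negCount-Φ C l)) (bar-even (topOf (L.map proj₁ C)))

-- … and, for even m, into S^D_{n,m}: |BAR| is even and at most var + 1 ≤ m + 1.
face-SDm : ∀ {k} m (C : List (PV (suc k))) → 2 ∣ m → IsFace m C → InSDm (suc k) m (Φ C)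
face-SDm m C em f@(a , l) = face-SD m C f ,
  subst (_≤ m) (sym (negCount-Φ C l))
   (even-le _ m (bar-even (topOf (L.map proj₁ C))) em (≤-trans (bar-bound (topOf (L.map proj₁ C))) (s≤s (topInP m C a))))

-- Chains in P_n: strict relations raise the weight, so chains are repetition-free and
-- have at most n elements.
ltP-below : ∀ {n} {a b : PV n} → a <P b → Below (proj₁ a) (proj₁ b)
ltP-below (inj₁ h , _) = inj₁ (zo h)
ltP-below (inj₂ h , _) = inj₂ (zo h)

ltP-wt : ∀ {n} {a b : PV n} → a <P b → wt (proj₁ a) < wt (proj₁ b)
ltP-wt {a = a , ra} {b , rb} (inj₁ h , ne) with m≤n⇒m<n∨m≡n (zo-wt h')
  where h' = zo {a = a} {b} h
... | inj₁ lt = lt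
... | inj₂ eq = ⊥-elim (ne (zo-wt-eq (zo {a = a} {b} h) eq))
ltP-wt {a = a , ra} {b , rb} (inj₂ h , ne) with m≤n⇒m<n∨m≡n (zo-wt h')
  where h' = zo {a = negV a} {b} h
... | inj₁ lt = subst (_< wt b) (wt-negV a) lt
... | inj₂ eq = ⊥-elim (rep-neg a ra (subst Rep (sym (zo-wt-eq (zo {a = negV a} {b} h) eq)) rb))

lt-ltP : ∀ {n} (a b : PV n) → Below (proj₁ a) (proj₁ b) → wt (proj₁ a) < wt (proj₁ b) → a <P b
lt-ltP a b (inj₁ (zo h)) lt = inj₁ h , (λ e → <⇒≢ lt (cong wt e))
lt-ltP a b (inj₂ (zo h)) lt = inj₂ h , (λ e → <⇒≢ lt (cong wt e))

rep-wt : ∀ {n} (ω : SignVec n) → NonZeroV ω → 0 < wt ω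
rep-wt [] supp = ⊥-elim (supp refl)
rep-wt (sm ∷ ω) supp = s≤s z≤n
rep-wt (s0 ∷ ω) supp = rep-wt ω supp
rep-wt (sp ∷ ω) supp = s≤s z≤n

WeightLess : ∀ {n} → PV n → PV n → Set
WeightLess a b = wt (proj₁ a) < wt (proj₁ b)

chain-weight-increasing : ∀ {n} {C : List (PV n)} → Linked _<P_ C → AllPairs WeightLess C
chain-weight-increasing l = Linked⇒AllPairs (λ {x} {y} {z} → <-trans) (Lk.map (λ {a} {b} r → ltP-wt {a = a} {b} r) l)

chain-distinct : ∀ {n} {C : List (PV n)} → Linked _<P_ C → AllPairs _≢_ C
chain-distinct l = AP.map (λ lt e → <⇒≢ lt (cong (λ x → wt (proj₁ x)) e)) (chain-weight-increasing l)

remove-∈ : ∀ {A : Set} {x : A} {ys} → x ∈ ys → Σ (List A) λ ys' → (length ys ≡ suc (length ys')) × (∀ z → z ∈ ys → z ≢ x → z ∈ ys')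
remove-∈ {ys = y ∷ ys} (here refl) = ys , refl , f
  where f : ∀ z → z ∈ (y ∷ ys) → z ≢ y → z ∈ ys
        f z (here e) ne = ⊥-elim (ne e)
        f z (there m) ne = m
remove-∈ {ys = y ∷ ys} (there m) with remove-∈ m
... | ys' , le , f = y ∷ ys' , cong suc le , g
  where g : ∀ z → z ∈ (y ∷ ys) → _ → z ∈ (y ∷ ys')
        g z (here e) ne = here e
        g z (there m') ne = there (f z m' ne)

pigeonhole : ∀ {A : Set} {xs ys : List A} → AllPairs _≢_ xs → (∀ z → z ∈ xs → z ∈ ys) → length xs ≤ length ys
pigeonhole {xs = []} u s = z≤n
pigeonhole {xs = x ∷ xs} {ys} (ax ∷ u) s with remove-∈ (s x (here refl))
... | ys' , le , f = subst (suc (length xs) ≤_) (sym le)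
      (s≤s (pigeonhole u (λ z m → f z (s z (there m)) (λ e → All.lookup ax m (sym e)))))

strict-chain-length : ∀ a n (xs : List ℕ) → a ≤ n → All (a <_) xs → AllPairs _<_ xs → All (_≤ n) xs → length xs + a ≤ n
strict-chain-length a n [] an _ _ _ = an
strict-chain-length a n (x ∷ xs) an (ax ∷ al) (px ∷ ap) (bx ∷ bl) =
  ≤-trans (≤-reflexive (sym (+-suc (length xs) a))) (≤-trans (+-monoʳ-≤ (length xs) ax) (strict-chain-length x n xs bx px ap bl))

face-length : ∀ {n} (C : List (PV n)) → Linked _<P_ C → length C ≤ n
face-length {n} C l = subst (_≤ n) (trans (+-identityʳ _) (LP.length-map (λ c → wt (proj₁ c)) C))
  (strict-chain-length 0 n (L.map (λ c → wt (proj₁ c)) C) z≤n (pos C) (APP.map⁺ (chain-weight-increasing l)) (bnd C))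
  where
  pos : ∀ C → All (0 <_) (L.map (λ c → wt (proj₁ c)) C)
  pos [] = []
  pos (c ∷ C) = rep-wt (proj₁ c) (rep-nz (proj₁ c) (proj₂ c)) ∷ pos C
  bnd : ∀ C → All (_≤ n) (L.map (λ c → wt (proj₁ c)) C)
  bnd [] = []
  bnd (c ∷ C) = wt≤n (proj₁ c) ∷ bnd C

-- A chain can be extended (keeping it inside P_{n,m}) unless every
-- element has one more nonzero entry than its predecessor and the top has no zero entry;
-- so facets are exactly the saturated flags below a full vector t.

gapV : ∀ {n} (a b : SignVec n) → ZO a b → wt a < wt b → Σ (SignVec n) λ y → ZO a y × ZO y b × wt y ≡ suc (wt a)
gapV [] [] h ()
gapV (x ∷ a) (z ∷ b) h lt with zo-head h
gapV (x ∷ a) (.x ∷ b) h lt | inj₂ refl with gapV a b (zo-tail h) (+-cancelˡ-< (ind (isNz x)) _ _ lt)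
... | y , h1 , h2 , e = x ∷ y , zo-cons (inj₂ refl) h1 , zo-cons (inj₂ refl) h2 , trans (cong (ind (isNz x) +_) e) (+-suc _ _)
gapV (s0 ∷ a) (s0 ∷ b) h lt | inj₁ refl with gapV a b (zo-tail h) lt
... | y , h1 , h2 , e = s0 ∷ y , zo-cons (inj₂ refl) h1 , zo-cons (inj₂ refl) h2 , e
gapV (s0 ∷ a) (sm ∷ b) h lt | inj₁ refl = sm ∷ a , zo-cons (inj₁ refl) (zo-refl a) , zo-cons (inj₂ refl) (zo-tail h) , refl
gapV (s0 ∷ a) (sp ∷ b) h lt | inj₁ refl = sp ∷ a , zo-cons (inj₁ refl) (zo-refl a) , zo-cons (inj₂ refl) (zo-tail h) , refl

-- fillV c t: fill the first zero entry of t by the sign of the preceding nonzero entry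
-- (c at the start); the result lies above t, has one more nonzero entry and no
-- additional sign change.
fillV : ∀ {n} → Sign → SignVec n → SignVec n
fillV c [] = []
fillV c (s0 ∷ t) = c ∷ t
fillV c (sm ∷ t) = sm ∷ fillV sm t
fillV c (sp ∷ t) = sp ∷ fillV sp t

fill-zo : ∀ {n} c (t : SignVec n) → ZO t (fillV c t)
fill-zo c [] = zo (λ ())
fill-zo c (s0 ∷ t) = zo-cons (inj₁ refl) (zo-refl t)
fill-zo c (sm ∷ t) = zo-cons (inj₂ refl) (fill-zo sm t)
fill-zo c (sp ∷ t) = zo-cons (inj₂ refl) (fill-zo sp t)

fill-wt : ∀ {n} c (t : SignVec n) → NonZeroS c → wt t < n → wt (fillV c t) ≡ suc (wt t)
fill-wt c [] e ()
fill-wt sm (s0 ∷ t) e lt = refl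
fill-wt sp (s0 ∷ t) e lt = refl
fill-wt s0 (s0 ∷ t) () lt
fill-wt c (sm ∷ t) e (s≤s lt) = cong suc (fill-wt sm t refl lt)
fill-wt c (sp ∷ t) e (s≤s lt) = cong suc (fill-wt sp t refl lt)

fill-changesFrom : ∀ {n} c (t : SignVec n) → NonZeroS c → changesFrom c (nonzeros (fillV c t)) ≡ changesFrom c (nonzeros t)
fill-changesFrom c [] e = refl
fill-changesFrom sm (s0 ∷ t) e = refl
fill-changesFrom sp (s0 ∷ t) e = refl
fill-changesFrom s0 (s0 ∷ t) () 
fill-changesFrom c (sm ∷ t) e = trans (changes-cons c sm (nonzeros (fillV sm t))) (trans (cong (ind (isMinus (c · sm)) +_) (fill-changesFrom sm t refl)) (sym (changes-cons c sm (nonzeros t))))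
fill-changesFrom c (sp ∷ t) e = trans (changes-cons c sp (nonzeros (fillV sp t))) (trans (cong (ind (isMinus (c · sp)) +_) (fill-changesFrom sp t refl)) (sym (changes-cons c sp (nonzeros t))))

RepOr0 : ∀ {n} → SignVec n → Set
RepOr0 t = (firstNz (toList t) ≡ nothing) ⊎ Rep t

fill-rep : ∀ {n} (t : SignVec (suc n)) → RepOr0 t → Rep (fillV sp t)
fill-rep (s0 ∷ t) r = refl
fill-rep (sp ∷ t) r = refl
fill-rep (sm ∷ t) (inj₁ ())
fill-rep (sm ∷ t) (inj₂ ())

changesFrom-sp-var : ∀ {n} (t : SignVec n) → RepOr0 t → changesFrom sp (nonzeros t) ≡ var t
changesFrom-sp-var [] r = refl
changesFrom-sp-var (s0 ∷ t) r = changesFrom-sp-var t r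
changesFrom-sp-var (sp ∷ t) r = refl
changesFrom-sp-var (sm ∷ t) (inj₁ ())
changesFrom-sp-var (sm ∷ t) (inj₂ ())

fill-var : ∀ {n} (t : SignVec n) → RepOr0 t → var (fillV sp t) ≤ var t
fill-var t r = ≤-trans (changesFrom-≥ sp (nonzeros (fillV sp t))) (≤-reflexive (trans (fill-changesFrom sp t refl) (changesFrom-sp-var t r)))

insTop : ∀ {k} m (p : SignVec (suc k)) → RepOr0 p → wt p < suc k → var p ≤ m →
  Σ (PV (suc k)) λ x → Below p (proj₁ x) × wt (proj₁ x) ≡ suc (wt p) × InP m x
insTop m p r lt vm = (fillV sp p , fill-rep p r) , inj₁ (fill-zo sp p) , fill-wt sp p refl lt , ≤-trans (fill-var p r) vm

nonzero-of-wt : ∀ {n} (y : SignVec n) → 0 < wt y → NonZeroV y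
nonzero-of-wt (sm ∷ y) lt ()
nonzero-of-wt (sp ∷ y) lt ()
nonzero-of-wt (s0 ∷ y) lt e = nonzero-of-wt y lt e

below-negL : ∀ {n} {y c : SignVec n} → Below y c → Below (negV y) c
below-negL (inj₁ h) = inj₂ (subst (λ v → ZO v _) (sym (negV-inv _)) h)
below-negL (inj₂ h) = inj₁ h

-- A gap of weight ≥ 2 between p and c can be filled by an element of P_{n,m}, since
-- anything below c has var ≤ var c ≤ m.
insGapCore : ∀ {k} m (p : SignVec (suc k)) (c : PV (suc k)) (b' : SignVec (suc k)) → ZO p b' → wt b' ≡ wt (proj₁ c) →
  (∀ y → ZO y b' → Below y (proj₁ c)) → suc (wt p) < wt (proj₁ c) → InP m c →
  Σ (PV (suc k)) λ x → Below p (proj₁ x) × wt (proj₁ x) ≡ suc (wt p) × x <P c × InP m x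
insGapCore m p c b' hpb wb conv lt ic with gapV p b' hpb (subst (wt p <_) (sym wb) (<-trans (n<1+n _) lt))
... | y , h1 , h2 , wy = x , bpx , wx , lt-ltP x c bxc (subst (_< wt (proj₁ c)) (sym wx) lt) , ≤-trans (below-var bxc) ic
  where
  x = normPV y
  ny : NonZeroV y
  ny = nonzero-of-wt y (subst (0 <_) (sym wy) (s≤s z≤n))
  bpx : Below p (proj₁ x)
  bpx with normPV-prop y ny
  ... | inj₁ e = inj₁ (subst (ZO p) (sym e) h1)
  ... | inj₂ e = inj₂ (subst (ZO (negV p)) (sym e) (zo-neg h1))
  bxc : Below (proj₁ x) (proj₁ c)
  bxc with normPV-prop y ny
  ... | inj₁ e = subst (λ v → Below v (proj₁ c)) (sym e) (conv y h2)
  ... | inj₂ e = subst (λ v → Below v (proj₁ c)) (sym e) (below-negL (conv y h2))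
  wx : wt (proj₁ x) ≡ suc (wt p)
  wx with normPV-prop y ny
  ... | inj₁ e = trans (cong wt e) wy
  ... | inj₂ e = trans (cong wt e) (trans (wt-negV y) wy)

insGap : ∀ {k} m (p : SignVec (suc k)) (c : PV (suc k)) → Below p (proj₁ c) → suc (wt p) < wt (proj₁ c) → InP m c →
  Σ (PV (suc k)) λ x → Below p (proj₁ x) × wt (proj₁ x) ≡ suc (wt p) × x <P c × InP m x
insGap m p c (inj₁ h) = insGapCore m p c (proj₁ c) h refl (λ y hy → inj₁ hy)
insGap m p c (inj₂ h) = insGapCore m p c (negV (proj₁ c))
  (subst (λ v → ZO v (negV (proj₁ c))) (negV-inv p) (zo-neg h)) (wt-negV (proj₁ c))
  (λ y hy → inj₂ (subst (ZO (negV y)) (negV-inv (proj₁ c)) (zo-neg hy)))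

eqFin : ∀ {n} → Fin n → Fin n → Bool
eqFin zero zero = true
eqFin zero (suc j) = false
eqFin (suc i) zero = false
eqFin (suc i) (suc j) = eqFin i j

eqFin-refl : ∀ {n} (i : Fin n) → eqFin i i ≡ true
eqFin-refl zero = refl
eqFin-refl (suc i) = eqFin-refl i

eqFin-≡ : ∀ {n} (i j : Fin n) → eqFin i j ≡ true → i ≡ j
eqFin-≡ zero zero e = refl
eqFin-≡ (suc i) (suc j) e = cong suc (eqFin-≡ i j e)
eqFin-≡ zero (suc j) ()
eqFin-≡ (suc i) zero ()

restrict : ∀ {n} → SignVec n → (Fin n → Bool) → SignVec n
restrict t S = V.tabulate (λ i → if S i then lookup t i else s0)

lookup-restrict : ∀ {n} (t : SignVec n) S i → lookup (restrict t S) i ≡ (if S i then lookup t i else s0)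
lookup-restrict t S i = lookup∘tabulate _ i

restrict-zo : ∀ {n} (t : SignVec n) S → ZO (restrict t S) t
restrict-zo t S = zo f where
  f : ZeroOut (restrict t S) t
  f i rewrite lookup-restrict t S i with S i
  ... | true = inj₂ refl
  ... | false = inj₁ refl

restrict-supp : ∀ {n} (t : SignVec n) S → (∀ i → S i ≡ true → supp t i ≡ true) → ∀ i → supp (restrict t S) i ≡ S i
restrict-supp t S h i rewrite lookup-restrict t S i with S i in e
... | true = h i e
... | false = refl

supp⇒nonzero : ∀ {n} (r : SignVec n) i → supp r i ≡ true → NonZeroV r
supp⇒nonzero (sm ∷ r) i e ()
supp⇒nonzero (sp ∷ r) i e ()
supp⇒nonzero (s0 ∷ r) zero () 
supp⇒nonzero (s0 ∷ r) (suc i) e = supp⇒nonzero r i e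

normPV-supp : ∀ {k} (r : SignVec (suc k)) → NonZeroV r → ∀ i → supp (proj₁ (normPV r)) i ≡ supp r i
normPV-supp r nr i with normPV-prop r nr
... | inj₁ e = cong (λ v → supp v i) e
... | inj₂ e = trans (cong (λ v → supp v i) e) (supp-negV r i)

normPV-below : ∀ {k} (r t : SignVec (suc k)) → NonZeroV r → ZO r t → Below (proj₁ (normPV r)) t
normPV-below r t nr h with normPV-prop r nr
... | inj₁ e = inj₁ (subst (λ v → ZO v t) (sym e) h)
... | inj₂ e = inj₂ (subst (λ v → ZO v t) (trans (sym (negV-inv r)) (cong negV (sym e))) h)

zeroOut-pointwise : ∀ {x y z} → (x ≡ s0) ⊎ (x ≡ z) → (y ≡ s0) ⊎ (y ≡ z) → isNz x ≡ isNz y → x ≡ y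
zeroOut-pointwise (inj₁ refl) (inj₁ refl) e = refl
zeroOut-pointwise {y = y} (inj₁ refl) (inj₂ refl) e = sym (isNz-false y (sym e))
zeroOut-pointwise {x = x} (inj₂ refl) (inj₁ refl) e = isNz-false x e
zeroOut-pointwise (inj₂ refl) (inj₂ refl) e = refl

zo-pt : ∀ {n} {a b : SignVec n} → ZO a b → ∀ i → (lookup a i ≡ s0) ⊎ (lookup a i ≡ lookup b i)
zo-pt (zo h) i = h i

same-branch : ∀ {n} {a b t : SignVec n} → ZO a t → ZO b t → (∀ i → supp a i ≡ supp b i) → a ≡ b
same-branch ha hb e = vext (λ i → zeroOut-pointwise (zo-pt ha i) (zo-pt hb i) (e i))

rep-unique : ∀ {n} (a b t : SignVec n) → Rep a → Rep b → Below a t → Below b t → (∀ i → supp a i ≡ supp b i) → a ≡ b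
rep-unique a b t ra rb (inj₁ ha) (inj₁ hb) e = same-branch ha hb e
rep-unique a b t ra rb (inj₂ ha) (inj₂ hb) e = trans (sym (negV-inv a)) (trans (cong negV (same-branch ha hb (λ i → trans (supp-negV a i) (trans (e i) (sym (supp-negV b i)))))) (negV-inv b))
rep-unique a b t ra rb (inj₁ ha) (inj₂ hb) e = ⊥-elim (rep-neg b rb (subst Rep (same-branch ha hb (λ i → trans (e i) (sym (supp-negV b i)))) ra))
rep-unique a b t ra rb (inj₂ ha) (inj₁ hb) e = ⊥-elim (rep-neg a ra (subst Rep (sym (same-branch ha hb (λ i → trans (supp-negV a i) (e i)))) rb))

countFin-+ : ∀ {n} (P Q R : Fin n → Bool) → (∀ i → ind (P i) ≡ ind (Q i) + ind (R i)) → countFin P ≡ countFin Q + countFin R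
countFin-+ {zero} P Q R h = refl
countFin-+ {suc n} P Q R h = trans (cong₂ _+_ (h zero) (countFin-+ (λ i → P (suc i)) (λ i → Q (suc i)) (λ i → R (suc i)) (λ i → h (suc i))))
  (ex (ind (Q zero)) (ind (R zero)) _ _)
  where ex : ∀ a b c d → (a + b) + (c + d) ≡ (a + c) + (b + d)
        ex = solve-∀

countFin-zero : ∀ {n} (B : Fin n → Bool) → countFin B ≡ 0 → ∀ i → B i ≡ false
countFin-zero B e zero with B zero
countFin-zero B e zero | false = refl
countFin-zero B () zero | true
countFin-zero B e (suc i) with B zero
... | false = countFin-zero (λ i → B (suc i)) e i
countFin-zero B () (suc i) | true

countFin-one : ∀ {n} (B : Fin n → Bool) → countFin B ≡ 1 → Σ (Fin n) λ j → B j ≡ true × (∀ i → B i ≡ true → i ≡ j)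
countFin-one {zero} B ()
countFin-one {suc n} B e with B zero in eb
... | true = zero , eb , uq
  where
  uq : ∀ i → B i ≡ true → i ≡ zero
  uq zero _ = refl
  uq (suc i) bi with trans (sym bi) (countFin-zero (λ i → B (suc i)) (suc-injective e) i)
  ... | ()
... | false with countFin-one (λ i → B (suc i)) e
... | j , bj , u = suc j , bj , uq
  where
  uq : ∀ i → B i ≡ true → i ≡ suc j
  uq zero bi with trans (sym bi) eb
  ... | ()
  uq (suc i) bi = cong suc (u i bi)

full-wt : ∀ {n} (p : SignVec n) → wt p ≡ n → ∀ i → supp p i ≡ true
full-wt (sm ∷ p) e zero = refl
full-wt (sp ∷ p) e zero = refl
full-wt (s0 ∷ p) e zero = ⊥-elim (<⇒≢ (s≤s (wt≤n p)) e)
full-wt (sm ∷ p) e (suc i) = full-wt p (suc-injective e) i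
full-wt (sp ∷ p) e (suc i) = full-wt p (suc-injective e) i
full-wt (s0 ∷ p) e (suc i) = ⊥-elim (<⇒≢ (s≤s (wt≤n p)) e)

StartsAbove : ∀ {n} → SignVec n → List (PV n) → Set
StartsAbove p [] = ⊤
StartsAbove p (d ∷ _) = Below p (proj₁ d) × wt p < wt (proj₁ d)

addIdx : ∀ {n} → (Fin n → Bool) → Fin n → Fin n → Bool
addIdx S j i = S i ∨ eqFin i j

addIdx-mono : ∀ {n} (S : Fin n → Bool) j i → S i ≡ true → addIdx S j i ≡ true
addIdx-mono S j i e rewrite e = refl

addIdx-self : ∀ {n} (S : Fin n → Bool) j → addIdx S j j ≡ true
addIdx-self S j = trans (cong (S j ∨_) (eqFin-refl j)) (∨-zeroʳ (S j))

flagChain : ∀ {k} → SignVec (suc k) → (Fin (suc k) → Bool) → List (Fin (suc k)) → List (PV (suc k))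
flagChain t S [] = []
flagChain t S (j ∷ js) = normPV (restrict t (addIdx S j)) ∷ flagChain t (addIdx S j) js

-- Enumerates S js: js lists, without repetition, exactly the indices outside S.
Enumerates : ∀ {n} → (Fin n → Bool) → List (Fin n) → Set
Enumerates S [] = ∀ i → S i ≡ true
Enumerates S (j ∷ js) = S j ≡ false × Enumerates (addIdx S j) js

WalkResult : ∀ {k} (m : ℕ) (t p : SignVec (suc k)) (S : Fin (suc k) → Bool) (C : List (PV (suc k))) → Set
WalkResult {k} m t p S C =
  (Σ (List (Fin (suc k))) λ js → Enumerates S js × C ≡ flagChain t S js × (∀ i → supp (topFrom p (L.map proj₁ C)) i ≡ true))
  ⊎ (Σ (List (PV (suc k))) λ D → All (InP m) D × Linked _<P_ D × StartsAbove p D × (∀ x → x ∈ C → x ∈ D) × length D ≡ suc (length C))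

one-new-index : ∀ {n} (S T : Fin n → Bool) → (∀ i → S i ≡ true → T i ≡ true) →
  countFin T ≡ suc (countFin S) → Σ (Fin n) λ j → S j ≡ false × (∀ i → addIdx S j i ≡ T i)
one-new-index S T S⊆T count = j , new-false , addIdx≡T
  where
  New : _ → Bool
  New i = T i ∧ not (S i)
  split : ∀ i → ind (T i) ≡ ind (New i) + ind (S i)
  split i with S i in eS | T i in eT
  ... | true | true = refl
  ... | true | false = ⊥-elim (false≢true (trans (sym eT) (S⊆T i eS)))
  ... | false | true = refl
  ... | false | false = refl
  one : countFin New ≡ 1
  one = +-cancelʳ-≡ (countFin S) (countFin New) 1 (trans (sym (countFin-+ T New S split)) count)
  j = proj₁ (countFin-one New one)
  newj = proj₁ (proj₂ (countFin-one New one))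
  unique = proj₂ (proj₂ (countFin-one New one))
  new-false : S j ≡ false
  new-false with S j | T j | newj
  ... | false | true | _ = refl
  addIdx≡T : ∀ i → addIdx S j i ≡ T i
  addIdx≡T i with eqFin i j in eij
  ... | true rewrite eqFin-≡ i j eij | new-false with T j | newj
  ...   | true | _ = refl
  addIdx≡T i | false rewrite ∨-identityʳ (S i) with S i in eS | T i in eT
  ... | true | _ = sym (trans (sym eT) (S⊆T i eS))
  ... | false | false = refl
  ... | false | true with unique i (subst₂ (λ x y → (x ∧ not y) ≡ true) (sym eT) (sym eS) refl)
  ...   | refl = ⊥-elim (false≢true (trans (sym eij) (eqFin-refl j)))

below-determined : ∀ {k} (t : SignVec (suc k)) (c : PV (suc k)) (S : Fin (suc k) → Bool) j →
  Below (proj₁ c) t → (∀ i → S i ≡ supp (proj₁ c) i) → S j ≡ true → c ≡ normPV (restrict t S)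
below-determined t c S j c≤t S≡supp Sj =
  pv-≡ (rep-unique (proj₁ c) (proj₁ (normPV r)) t (proj₂ c) (proj₂ (normPV r)) c≤t
         (normPV-below r t r≠0 (restrict-zo t S))
         (λ i → sym (trans (normPV-supp r r≠0 i) (trans (supp-r i) (S≡supp i)))))
  where
  r = restrict t S
  supp-r : ∀ i → supp r i ≡ S i
  supp-r = restrict-supp t S (λ i e → below-supp c≤t i (trans (sym (S≡supp i)) e))
  r≠0 : NonZeroV r
  r≠0 = supp⇒nonzero r j (trans (supp-r j) Sj)

cover-step : ∀ {k} (t p : SignVec (suc k)) (c : PV (suc k)) S → (∀ i → S i ≡ supp p i) →
  Below p (proj₁ c) → Below (proj₁ c) t → wt (proj₁ c) ≡ suc (wt p) →
  Σ (Fin (suc k)) λ j → S j ≡ false × (∀ i → addIdx S j i ≡ supp (proj₁ c) i) × c ≡ normPV (restrict t (addIdx S j))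
cover-step t p c S S≡supp p≤c c≤t wc with one-new-index S (supp (proj₁ c))
    (λ i e → below-supp p≤c i (trans (sym (S≡supp i)) e))
    (trans (sym (wt-cnt (proj₁ c))) (trans wc (cong suc (trans (wt-cnt p) (countFin-cong (λ i → sym (S≡supp i)))))))
... | j , Sj , addIdx≡supp = j , Sj , addIdx≡supp ,
      below-determined t c (addIdx S j) j c≤t addIdx≡supp (addIdx-self S j)

-- Walking up a chain from p: each element either covers the previous one (cover-step)
-- or leaves a gap that can be filled (insGap); at the top, either p is full or it can be
-- extended (insTop).
walk : ∀ {k} m (t p : SignVec (suc k)) (S : Fin (suc k) → Bool) (C : List (PV (suc k)))
  → (∀ i → S i ≡ supp p i) → RepOr0 p → var p ≤ m → StartsAbove p C → Linked _<P_ C → All (InP m) C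
  → All (λ c → Below (proj₁ c) t) C → WalkResult m t p S C
walk {k} m t p S [] S≡supp p-rep p-var _ _ _ _ with m≤n⇒m<n∨m≡n (wt≤n p)
... | inj₁ p-not-full with insTop m p p-rep p-not-full p-var
...   | x , p≤x , wx , x∈P =
        inj₂ ([ x ] , x∈P ∷ [] , [-] , (p≤x , subst (wt p <_) (sym wx) (n<1+n _)) , (λ _ ()) , refl)
walk {k} m t p S [] S≡supp _ _ _ _ _ _ | inj₂ p-full =
  inj₁ ([] , (λ i → trans (S≡supp i) (full-wt p p-full i)) , refl , full-wt p p-full)
walk {k} m t p S (c ∷ C) S≡supp p-rep p-var (p≤c , p<c) chain (c∈P ∷ C∈P) (c≤t ∷ C≤t)
  with m≤n⇒m<n∨m≡n p<c
... | inj₁ gap with insGap m p c p≤c gap c∈P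
...   | x , p≤x , wx , x<c , x∈P =
        inj₂ (x ∷ c ∷ C , x∈P ∷ c∈P ∷ C∈P , x<c ∷ chain ,
              (p≤x , subst (wt p <_) (sym wx) (n<1+n _)) , (λ _ → there) , refl)
walk {k} m t p S (c ∷ C) S≡supp p-rep p-var (p≤c , p<c) chain (c∈P ∷ C∈P) (c≤t ∷ C≤t) | inj₂ covers
  with cover-step t p c S S≡supp p≤c c≤t (sym covers)
... | j , Sj , addIdx≡supp , c≡ with walk m t (proj₁ c) (addIdx S j) C addIdx≡supp (inj₂ (proj₂ c)) c∈P
                                    (above-c C chain) (tail-linked chain) C∈P C≤t
  where
  above-c : ∀ C → Linked _<P_ (c ∷ C) → StartsAbove (proj₁ c) C
  above-c [] _ = tt
  above-c (d ∷ C) (c<d ∷ _) = ltP-below {a = c} {d} c<d , ltP-wt {a = c} {d} c<d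
  tail-linked : Linked _<P_ (c ∷ C) → Linked _<P_ C
  tail-linked [-] = []
  tail-linked (_ ∷ l) = l
... | inj₁ (js , ns , C≡ , full) = inj₁ (j ∷ js , (Sj , ns) , cong₂ _∷_ c≡ C≡ , full)
... | inj₂ (D , D∈P , D-chain , D-above , C⊆D , len) =
        inj₂ (c ∷ D , c∈P ∷ D∈P , prepend D D-chain D-above , (p≤c , p<c) , c∷C⊆c∷D , cong suc len)
  where
  prepend : ∀ D → Linked _<P_ D → StartsAbove (proj₁ c) D → Linked _<P_ (c ∷ D)
  prepend [] _ _ = [-]
  prepend (d ∷ D) D-chain (c≤d , c<d) = lt-ltP c d c≤d c<d ∷ D-chain
  c∷C⊆c∷D : ∀ x → x ∈ (c ∷ C) → x ∈ (c ∷ D)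
  c∷C⊆c∷D x (here e) = here e
  c∷C⊆c∷D x (there x∈C) = there (C⊆D x x∈C)

allBelow : ∀ {n} (c : PV n) (C : List (PV n)) → Linked _<P_ (c ∷ C) →
  All (λ x → Below (proj₁ x) (topFrom (proj₁ c) (L.map proj₁ C))) (c ∷ C)
allBelow c [] l = inj₁ (zo-refl (proj₁ c)) ∷ []
allBelow c (d ∷ C) (r ∷ l) with allBelow d C l
... | bd ∷ rest = below-trans (ltP-below {a = c} {d} r) bd ∷ bd ∷ rest

topRep : ∀ {n} (c : PV n) (C : List (PV n)) → Rep (topFrom (proj₁ c) (L.map proj₁ C))
topRep c [] = proj₂ c
topRep c (d ∷ C) = topRep d C

var-zero : ∀ n m → var (zeroVec n) ≤ m
var-zero zero m = z≤n
var-zero (suc n) m = var-zero n m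

firstNz-zero : ∀ n → firstNz (toList (zeroVec n)) ≡ nothing
firstNz-zero zero = refl
firstNz-zero (suc n) = firstNz-zero n

IsFlag : ∀ {k} → List (PV (suc k)) → Set
IsFlag {k} C = Σ (SignVec (suc k)) λ t → Σ (List (Fin (suc k))) λ js →
  Rep t × (∀ i → supp t i ≡ true) × Enumerates (λ _ → false) js × C ≡ flagChain t (λ _ → false) js

walkFromZero : ∀ {k} m (t : SignVec (suc k)) (C : List (PV (suc k))) →
  StartsAbove (zeroVec (suc k)) C → IsFace m C → All (λ c → Below (proj₁ c) t) C →
  WalkResult m t (zeroVec (suc k)) (λ _ → false) C
walkFromZero {k} m t C above (a , l) below =
  walk m t (zeroVec (suc k)) (λ _ → false) C (λ i → sym (cong isNz (lookup-zero (suc k) i)))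
    (inj₁ (firstNz-zero (suc k))) (var-zero (suc k) m) above l a below

-- A facet is not contained in a strictly longer face (faces are repetition-free).
facet-maximal : ∀ {n} m (C D : List (PV n)) → IsFacet m C → IsFace m D →
  (∀ x → x ∈ C → x ∈ D) → length D ≡ suc (length C) → ⊥
facet-maximal m C D (_ , maximal) (aD , lD) C⊆D len =
  <⇒≱ (subst (length C <_) (sym len) (n<1+n _)) (pigeonhole (chain-distinct lD) (maximal D (aD , lD) C⊆D))

-- Every facet is a flag: otherwise the walk produces a longer face containing it.
facet-is-flag : ∀ {k} m (C : List (PV (suc k))) → IsFacet m C → IsFlag C
facet-is-flag {k} m [] facet@(face , _) with walkFromZero m (zeroVec (suc k)) [] tt face []
... | inj₁ ([] , ns , _ , _) = ⊥-elim (false≢true (ns zero))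
... | inj₂ (D , aD , lD , _ , sub , len) = ⊥-elim (facet-maximal m [] D facet (aD , lD) sub len)
facet-is-flag {k} m (c ∷ C) facet@(face@(_ , l) , _)
  with walkFromZero m (topFrom (proj₁ c) (L.map proj₁ C)) (c ∷ C) above face (allBelow c C l)
  where
  above : StartsAbove (zeroVec (suc k)) (c ∷ C)
  above = inj₁ (zo-zero (proj₁ c)) ,
          subst (_< wt (proj₁ c)) (sym (wt-zero (suc k))) (rep-wt (proj₁ c) (rep-nz (proj₁ c) (proj₂ c)))
... | inj₁ (js , ns , eq , full) = topFrom (proj₁ c) (L.map proj₁ C) , js , topRep c C , full , ns , eq
... | inj₂ (D , aD , lD , _ , sub , len) = ⊥-elim (facet-maximal m (c ∷ C) D facet (aD , lD) sub len)

Full : ∀ {n} → SignVec n → Set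
Full {n} t = ∀ (i : Fin n) → supp t i ≡ true

-- Flags of a full vector t are faces: restrictions of t have weights 1, 2, …, n, and
-- var(restrict t S) ≤ var t.
wt-restrict : ∀ {n} (t : SignVec n) S → Full t → wt (restrict t S) ≡ countFin S
wt-restrict t S ft = trans (wt-cnt (restrict t S)) (countFin-cong (restrict-supp t S (λ i _ → ft i)))

countFin-addIdx : ∀ {n} (S : Fin n → Bool) j → S j ≡ false → countFin (addIdx S j) ≡ suc (countFin S)
countFin-addIdx {suc n} S zero sj rewrite sj = cong suc (countFin-cong (λ i → ∨-identityʳ (S (suc i))))
countFin-addIdx {suc n} S (suc j) sj = trans (cong (_+ countFin (λ i → S (suc i) ∨ eqFin i j)) (cong ind (∨-identityʳ (S zero))))
  (trans (cong (ind (S zero) +_) (countFin-addIdx (λ i → S (suc i)) j sj)) (+-suc _ _))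

countFin-all : ∀ {n} (S : Fin n → Bool) → (∀ i → S i ≡ true) → countFin S ≡ n
countFin-all {zero} S h = refl
countFin-all {suc n} S h rewrite h zero = cong suc (countFin-all (λ i → S (suc i)) (λ i → h (suc i)))

enumerates-length : ∀ {n} (S : Fin n → Bool) js → Enumerates S js → length js + countFin S ≡ n
enumerates-length S [] ns = countFin-all S ns
enumerates-length S (j ∷ js) (sj , ns) = trans (sym (+-suc (length js) (countFin S))) (trans (cong (length js +_) (sym (countFin-addIdx S j sj))) (enumerates-length (addIdx S j) js ns))

flagChain-length : ∀ {k} (t : SignVec (suc k)) S js → length (flagChain t S js) ≡ length js
flagChain-length t S [] = refl
flagChain-length t S (j ∷ js) = cong suc (flagChain-length t (addIdx S j) js)

restrict-nonzero : ∀ {k} (t : SignVec (suc k)) S j → Full t → NonZeroV (restrict t (addIdx S j))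
restrict-nonzero t S j ft = supp⇒nonzero (restrict t (addIdx S j)) j (trans (restrict-supp t (addIdx S j) (λ i _ → ft i) j) (addIdx-self S j))

zo-restrict : ∀ {n} (t : SignVec n) S S' → (∀ i → S i ≡ true → S' i ≡ true) → ZO (restrict t S) (restrict t S')
zo-restrict t S S' h = zo f where
  f : ZeroOut (restrict t S) (restrict t S')
  f i rewrite lookup-restrict t S i | lookup-restrict t S' i with S i in e
  ... | false = inj₁ refl
  ... | true rewrite h i e = inj₂ refl

norm-below-norm : ∀ {k} (a b : SignVec (suc k)) → NonZeroV a → NonZeroV b → ZO a b → Below (proj₁ (normPV a)) (proj₁ (normPV b))
norm-below-norm a b na nb h with normPV-prop a na | normPV-prop b nb
... | inj₁ ea | inj₁ eb = inj₁ (subst₂ ZO (sym ea) (sym eb) h)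
... | inj₁ ea | inj₂ eb = inj₂ (subst₂ ZO (sym (cong negV ea)) (sym eb) (zo-neg h))
... | inj₂ ea | inj₁ eb = inj₂ (subst₂ ZO (trans (sym (negV-inv a)) (sym (cong negV ea))) (sym eb) h)
... | inj₂ ea | inj₂ eb = inj₁ (subst₂ ZO (sym ea) (sym eb) (zo-neg h))

wt-norm : ∀ {k} (r : SignVec (suc k)) → NonZeroV r → wt (proj₁ (normPV r)) ≡ wt r
wt-norm r nr with normPV-prop r nr
... | inj₁ e = cong wt e
... | inj₂ e = trans (cong wt e) (wt-negV r)

var-norm : ∀ {k} (r : SignVec (suc k)) → NonZeroV r → var (proj₁ (normPV r)) ≡ var r
var-norm r nr with normPV-prop r nr
... | inj₁ e = cong var e
... | inj₂ e = trans (cong var e) (var-negV r)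

chain-face : ∀ {k} m (t : SignVec (suc k)) S js → Full t → var t ≤ m → Enumerates S js →
  All (InP m) (flagChain t S js) × Linked _<P_ (flagChain t S js)
chain-face m t S [] ft vt ns = [] , []
chain-face {k} m t S (j ∷ js) ft vt (sj , ns) with chain-face m t (addIdx S j) js ft vt ns
... | a , l = ip ∷ a , lk js ns l
  where
  r = restrict t (addIdx S j)
  ip : InP m (normPV r)
  ip = subst (_≤ m) (sym (var-norm r (restrict-nonzero t S j ft))) (≤-trans (var-mono (restrict-zo t (addIdx S j))) vt)
  lk : ∀ js → Enumerates (addIdx S j) js → Linked _<P_ (flagChain t (addIdx S j) js) → Linked _<P_ (normPV r ∷ flagChain t (addIdx S j) js)
  lk [] _ _ = [-]
  lk (j' ∷ js') (sj' , _) l' = lt-ltP (normPV r) (normPV r')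
      (norm-below-norm r r' (restrict-nonzero t S j ft) (restrict-nonzero t (addIdx S j) j' ft) (zo-restrict t (addIdx S j) (addIdx (addIdx S j) j') (addIdx-mono (addIdx S j) j')))
      (subst₂ _<_ (sym (trans (wt-norm r (restrict-nonzero t S j ft)) (wt-restrict t (addIdx S j) ft))) (sym (trans (wt-norm r' (restrict-nonzero t (addIdx S j) j' ft)) (wt-restrict t (addIdx (addIdx S j) j') ft)))
        (≤-reflexive (sym (countFin-addIdx (addIdx S j) j' sj'))))
      ∷ l'
    where r' = restrict t (addIdx (addIdx S j) j')

-- A face with n elements is a facet (no face is longer, by face-length).
full-face-is-facet : ∀ {k} m (C : List (PV (suc k))) → IsFace m C → length C ≡ suc k → IsFacet m C
full-face-is-facet {k} m C (a , l) len = (a , l) , mx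
  where
  open import Data.List.Membership.DecPropositional _≟PV_ using (_∈?_)
  mx : (D : List (PV (suc k))) → IsFace m D → (∀ x → x ∈ C → x ∈ D) → ∀ x → x ∈ D → x ∈ C
  mx D (aD , lD) sub x xD with x ∈? C
  ... | yes xC = xC
  ... | no xC with remove-∈ xD
  ... | D' , lenD , f = ⊥-elim (<⇒≱ lt (pigeonhole (chain-distinct l) (λ z zC → f z (sub z zC) (λ e → xC (subst (_∈ C) e zC)))))
    where
    lt : length D' < length C
    lt = subst (length D' <_) (sym len) (subst (_≤ suc k) lenD (face-length D lD))

-- The image of a flag: each block is a single index, so Φ reads off the enumeration in
-- reverse, signed by BAR(t).
filterᵇ-false : ∀ {A : Set} (P : A → Bool) → (∀ i → P i ≡ false) → ∀ xs → filterᵇ P xs ≡ []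
filterᵇ-false P h [] = refl
filterᵇ-false P h (x ∷ xs) rewrite filterᵇ-cons P x xs | h x = filterᵇ-false P h xs

filterᵇ-map : ∀ {A B : Set} (P : B → Bool) (f : A → B) xs → filterᵇ P (L.map f xs) ≡ L.map f (filterᵇ (λ x → P (f x)) xs)
filterᵇ-map P f [] = refl
filterᵇ-map P f (x ∷ xs) rewrite filterᵇ-cons P (f x) (L.map f xs) | filterᵇ-cons (λ x → P (f x)) x xs with P (f x)
... | true = cong (f x ∷_) (filterᵇ-map P f xs)
... | false = filterᵇ-map P f xs

allFin-suc : ∀ n → allFin (suc n) ≡ zero ∷ L.map suc (allFin n)
allFin-suc n = cong (zero ∷_) (sym (LP.map-tabulate (λ i → i) suc))

filterᵇ-allFin : ∀ {n} (P : Fin (suc n) → Bool) → filterᵇ P (allFin (suc n)) ≡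
  (if P zero then zero ∷ L.map suc (filterᵇ (λ x → P (suc x)) (allFin n)) else L.map suc (filterᵇ (λ x → P (suc x)) (allFin n)))
filterᵇ-allFin {n} P = trans (cong (filterᵇ P) (allFin-suc n)) (trans (filterᵇ-cons P zero (L.map suc (allFin n)))
  (cong (λ l → if P zero then zero ∷ l else l) (filterᵇ-map P suc (allFin n))))

filterᵇ-single : ∀ {n} (P : Fin n → Bool) j c → (∀ i → P i ≡ (eqFin i j ∧ c)) → filterᵇ P (allFin n) ≡ (if c then [ j ] else [])
filterᵇ-single {suc n} P zero c h = trans (filterᵇ-allFin P) (trans (cong₂ (λ b l → if b then zero ∷ L.map suc l else L.map suc l) (h zero)
   (filterᵇ-false (λ x → P (suc x)) (λ i → h (suc i)) (allFin n))) (fin c))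
  where fin : ∀ c → (if c then zero ∷ [] else []) ≡ (if c then [ zero ] else [])
        fin true = refl
        fin false = refl
filterᵇ-single {suc n} P (suc j) c h = trans (filterᵇ-allFin P) (trans (cong₂ (λ b l → if b then zero ∷ L.map suc l else L.map suc l) (h zero)
   (filterᵇ-single (λ x → P (suc x)) j c (λ i → h (suc i)))) (fin c))
  where fin : ∀ c → L.map suc (if c then [ j ] else []) ≡ (if c then [ suc j ] else [])
        fin true = refl
        fin false = refl

word-false : ∀ {n} (bar I : Fin n → Bool) → (∀ i → I i ≡ false) → word bar I ≡ []
word-false {n} bar I h rewrite filterᵇ-false (λ i → I i ∧ bar i) (λ i → cong (_∧ bar i) (h i)) (allFin n)
  | filterᵇ-false (λ i → I i ∧ not (bar i)) (λ i → cong (_∧ not (bar i)) (h i)) (allFin n) = refl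

single-∧-bar : ∀ {n} (bar I : Fin n → Bool) j → (∀ i → I i ≡ eqFin i j) → ∀ i → (I i ∧ bar i) ≡ (eqFin i j ∧ bar j)
single-∧-bar bar I j h i rewrite h i with eqFin i j in e
... | false = refl
... | true rewrite eqFin-≡ i j e = refl

single-∧-not-bar : ∀ {n} (bar I : Fin n → Bool) j → (∀ i → I i ≡ eqFin i j) → ∀ i → (I i ∧ not (bar i)) ≡ (eqFin i j ∧ not (bar j))
single-∧-not-bar bar I j h i rewrite h i with eqFin i j in e
... | false = refl
... | true rewrite eqFin-≡ i j e = refl

word-single : ∀ {n} (bar I : Fin n → Bool) j → (∀ i → I i ≡ eqFin i j) → word bar I ≡ [ signedZ bar j ]
word-single {n} bar I j h
  rewrite filterᵇ-single (λ i → I i ∧ bar i) j (bar j) (single-∧-bar bar I j h)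
  | filterᵇ-single (λ i → I i ∧ not (bar i)) j (not (bar j)) (single-∧-not-bar bar I j h) with bar j
... | true = refl
... | false = refl

SingletonBlocks : ∀ {n} → List (Fin n → Bool) → List (Fin n) → Set
SingletonBlocks [] [] = ⊤
SingletonBlocks [] (_ ∷ _) = ⊥
SingletonBlocks (_ ∷ _) [] = ⊥
SingletonBlocks (B ∷ Bs) (j ∷ js) = (∀ i → B i ≡ eqFin i j) × SingletonBlocks Bs js

supp-normPV-restrict : ∀ {k} (t : SignVec (suc k)) S j → Full t → ∀ i → supp (proj₁ (normPV (restrict t (addIdx S j)))) i ≡ addIdx S j i
supp-normPV-restrict t S j ft i = trans (normPV-supp (restrict t (addIdx S j)) (restrict-nonzero t S j ft) i) (restrict-supp t (addIdx S j) (λ i _ → ft i) i)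

blocks-singletons : ∀ {k} (t : SignVec (suc k)) (p : SignVec (suc k)) S js → Full t → (∀ i → supp p i ≡ S i) → Enumerates S js →
  SingletonBlocks (blocks p (L.map proj₁ (flagChain t S js))) js
blocks-singletons t p S [] ft hp ns = tt
blocks-singletons t p S (j ∷ js) ft hp (sj , ns) = pt , blocks-singletons t _ (addIdx S j) js ft (supp-normPV-restrict t S j ft) ns
  where
  pt : ∀ i → (supp (proj₁ (normPV (restrict t (addIdx S j)))) i ∧ not (supp p i)) ≡ eqFin i j
  pt i rewrite supp-normPV-restrict t S j ft i | hp i with eqFin i j in e
  ... | true rewrite eqFin-≡ i j e | sj = refl
  ... | false with S i
  ... | true = refl
  ... | false = refl

restrict-all : ∀ {n} (t : SignVec n) S → (∀ i → S i ≡ true) → restrict t S ≡ t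
restrict-all t S h = vext (λ i → trans (lookup-restrict t S i) (cong (λ b → if b then lookup t i else s0) (h i)))

top-chain : ∀ {k} (t : SignVec (suc k)) → Rep t → Full t → ∀ p S j js → Enumerates (addIdx S j) js →
  topFrom p (L.map proj₁ (flagChain t S (j ∷ js))) ≡ t
top-chain t rt ft p S j [] ns = trans (cong (λ v → proj₁ (normPV v)) (restrict-all t (addIdx S j) ns)) (normPV-rep t rt)
top-chain t rt ft p S j (j' ∷ js) (_ , ns) = top-chain t rt ft (proj₁ (normPV (restrict t (addIdx S j)))) (addIdx S j) j' js ns

words-singletons : ∀ {n} (bar : Fin n → Bool) Bs js → SingletonBlocks Bs js → L.map (word bar) Bs ≡ L.map (λ j → [ signedZ bar j ]) js
words-singletons bar [] [] p = refl
words-singletons bar (B ∷ Bs) (j ∷ js) (h , p) = cong₂ _∷_ (word-single bar B j h) (words-singletons bar Bs js p)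

Φ-chain : ∀ {k} (t : SignVec (suc k)) → Rep t → Full t → ∀ js → Enumerates (λ _ → false) js →
  Φ (flagChain t (λ _ → false) js) ≡ reverse (L.map (signedZ (inBAR t)) js)
Φ-chain {k} t rt ft [] ns with ns zero
... | ()
Φ-chain {k} t rt ft (j ∷ js) ns = begin
  Φ C
    ≡⟨ cong (λ v → concat (L.map (word (inBAR v)) (reverse (Bs L.++ [ F v ])))) topEq ⟩
  concat (L.map (word bar) (reverse (Bs L.++ [ F t ])))
    ≡⟨ cong (λ l → concat (L.map (word bar) l)) (LP.reverse-++ Bs [ F t ]) ⟩
  word bar (F t) ++ concat (L.map (word bar) (reverse Bs))
    ≡⟨ cong (_++ concat (L.map (word bar) (reverse Bs))) (word-false bar (F t) (λ i → cong not (ft i))) ⟩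
  concat (L.map (word bar) (reverse Bs))
    ≡⟨ cong concat (LP.reverse-map (word bar) Bs) ⟩
  concat (reverse (L.map (word bar) Bs))
    ≡⟨ cong (λ l → concat (reverse l)) (words-singletons bar Bs (j ∷ js) singletons) ⟩
  concat (reverse (L.map (λ j → [ signedZ bar j ]) (j ∷ js)))
    ≡⟨ cong (λ l → concat (reverse l)) (LP.map-∘ {g = [_]} {f = signedZ bar} (j ∷ js)) ⟩
  concat (reverse (L.map [_] (L.map (signedZ bar) (j ∷ js))))
    ≡⟨ cong concat (sym (LP.reverse-map [_] (L.map (signedZ bar) (j ∷ js)))) ⟩
  concat (L.map [_] (reverse (L.map (signedZ bar) (j ∷ js))))
    ≡⟨ LP.concat-map-[ _ ] ⟩
  reverse (L.map (signedZ bar) (j ∷ js)) ∎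
  where
  open ≡-Reasoning
  C = flagChain t (λ _ → false) (j ∷ js)
  ws = L.map proj₁ C
  Bs = blocks (zeroVec (suc k)) ws
  F : SignVec (suc k) → Fin (suc k) → Bool
  F v i = not (isNz (lookup v i))
  bar = inBAR t
  topEq : topOf ws ≡ t
  topEq = trans (topOf-eq ws) (top-chain t rt ft (zeroVec (suc k)) (λ _ → false) j js (proj₂ ns))
  singletons : SingletonBlocks Bs (j ∷ js)
  singletons = blocks-singletons t (zeroVec (suc k)) (λ _ → false) (j ∷ js) ft (λ i → cong isNz (lookup-zero (suc k) i)) ns

-- Injectivity: for a full representative t, BAR(t) determines t, because i + 1 is a flip
-- iff t_i and t_{i+1} differ and t_0 = +.
full-lookupℕ : ∀ {n} (t : SignVec n) → Full t → ∀ a → a < n → isNz (lookupℕ t a) ≡ true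
full-lookupℕ t ft a lt = trans (cong isNz (trans (sym (cong (lookupℕ t) (toℕ-fromℕ< lt))) (sym (lookup-ℕ t (fromℕ< lt))))) (ft (fromℕ< lt))

prefix-snoc : ∀ {n} (t : SignVec n) a → prefix t (suc a) ≡ prefix t a ++ [ lookupℕ t a ]
prefix-snoc t a = trans (cong (L.map (lookupℕ t)) (range-snoc 0 a)) (LP.map-++ (lookupℕ t) (range 0 a) [ a ])

pushSign-nonzero : ∀ pm y → isNz y ≡ true → pushSign pm y ≡ just y
pushSign-nonzero pm sm e = refl
pushSign-nonzero pm sp e = refl
pushSign-nonzero pm s0 ()

inBAR-suc : ∀ {k} (t : SignVec (suc k)) → Full t → ∀ (i : Fin k) →
  inBAR t (suc i) ≡ isMinus (lookupℕ t (toℕ i) · lookupℕ t (suc (toℕ i)))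
inBAR-suc {k} t ft i = trans (inBAR-char t (suc i))
  (cong₂ (λ m x → opposes (m <∣> lastNz (prefix t (suc k))) x)
    (trans (cong lastNz (prefix-snoc t (toℕ i))) (trans (lastNz-snoc (prefix t (toℕ i)) _) (pushSign-nonzero _ _ (full-lookupℕ t ft (toℕ i) (<-trans (toℕ<n i) (n<1+n k))))))
    (lookup-ℕ t (suc i)))

full-rep-head : ∀ {k} (t : SignVec (suc k)) → Rep t → Full t → lookupℕ t 0 ≡ sp
full-rep-head (sp ∷ t) rt ft = refl
full-rep-head (sm ∷ t) () ft
full-rep-head (s0 ∷ t) rt ft with ft zero
... | ()

sign-determined : ∀ x y y' → isNz x ≡ true → isNz y ≡ true → isNz y' ≡ true → isMinus (x · y) ≡ isMinus (x · y') → y ≡ y'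
sign-determined sm sm sm _ _ _ _ = refl
sign-determined sm sp sp _ _ _ _ = refl
sign-determined sp sm sm _ _ _ _ = refl
sign-determined sp sp sp _ _ _ _ = refl
sign-determined sm sm sp _ _ _ ()
sign-determined sm sp sm _ _ _ ()
sign-determined sp sm sp _ _ _ ()
sign-determined sp sp sm _ _ _ ()
sign-determined s0 _ _ () _ _ _
sign-determined _ s0 _ _ () _ _
sign-determined sm sm s0 _ _ () _
sign-determined sm sp s0 _ _ () _
sign-determined sp sm s0 _ _ () _
sign-determined sp sp s0 _ _ () _

bar-det : ∀ {k} (t t' : SignVec (suc k)) → Rep t → Rep t' → Full t → Full t' → (∀ i → inBAR t i ≡ inBAR t' i) → t ≡ t'
bar-det {k} t t' rt rt' ft ft' hb = vext (λ i → trans (lookup-ℕ t i) (trans (det (toℕ i) (toℕ<n i)) (sym (lookup-ℕ t' i))))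
  where
  det : ∀ a → a < suc k → lookupℕ t a ≡ lookupℕ t' a
  det zero lt = trans (full-rep-head t rt ft) (sym (full-rep-head t' rt' ft'))
  det (suc a) (s≤s lt) = sign-determined (lookupℕ t' a) (lookupℕ t (suc a)) (lookupℕ t' (suc a))
      (full-lookupℕ t' ft' a (<-trans lt (n<1+n k))) (full-lookupℕ t ft (suc a) (s≤s lt)) (full-lookupℕ t' ft' (suc a) (s≤s lt))
      (trans (cong (λ x → isMinus (x · lookupℕ t (suc a))) (sym ih)) E')
    where
    i : Fin k
    i = fromℕ< lt
    ih : lookupℕ t a ≡ lookupℕ t' a
    ih = det a (<-trans lt (n<1+n k))
    E : isMinus (lookupℕ t (toℕ i) · lookupℕ t (suc (toℕ i))) ≡ isMinus (lookupℕ t' (toℕ i) · lookupℕ t' (suc (toℕ i)))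
    E = trans (sym (inBAR-suc t ft i)) (trans (hb (suc i)) (inBAR-suc t' ft' i))
    E' : isMinus (lookupℕ t a · lookupℕ t (suc a)) ≡ isMinus (lookupℕ t' a · lookupℕ t' (suc a))
    E' = subst (λ b → isMinus (lookupℕ t b · lookupℕ t (suc b)) ≡ isMinus (lookupℕ t' b · lookupℕ t' (suc b))) (toℕ-fromℕ< lt) E

enumerates-cover : ∀ {n} (S : Fin n → Bool) js → Enumerates S js → ∀ i → S i ≡ true ⊎ i ∈ js
enumerates-cover S [] ns i = inj₁ (ns i)
enumerates-cover S (j ∷ js) (sj , ns) i with enumerates-cover (addIdx S j) js ns i
... | inj₂ m = inj₂ (there m)
... | inj₁ e with S i | eqFin i j in eij
... | true | _ = inj₁ refl
... | false | true = inj₂ (here (eqFin-≡ i j eij))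
... | false | false with e
... | ()

map-pointwise : ∀ {A B : Set} (f g : A → B) {xs} → L.map f xs ≡ L.map g xs → ∀ {x} → x ∈ xs → f x ≡ g x
map-pointwise f g {y ∷ ys} e (here refl) = proj₁ (LP.∷-injective e)
map-pointwise f g {y ∷ ys} e (there m) = map-pointwise f g (proj₂ (LP.∷-injective e)) m

signedZ-bar : ∀ {n} (b b' : Fin n → Bool) j → signedZ b j ≡ signedZ b' j → b j ≡ b' j
signedZ-bar b b' j e with b j | b' j
... | true | true = refl
... | false | false = refl
... | true | false with e
... | ()
signedZ-bar b b' j e | false | true with e
... | ()

sucToℕ-inj : ∀ {n} {i j : Fin n} → suc (toℕ i) ≡ suc (toℕ j) → i ≡ j
sucToℕ-inj e = toℕ-injective (suc-injective e)

facet-inj : ∀ {k} m (C D : List (PV (suc k))) → IsFacet m C → IsFacet m D → Φ C ≡ Φ D → C ≡ D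
facet-inj m C D C-facet D-facet ΦC≡ΦD with facet-is-flag m C C-facet | facet-is-flag m D D-facet
... | t , js , rt , ft , ns , C≡ | t' , js' , rt' , ft' , ns' , D≡ = trans C≡ (trans flags≡ (sym D≡))
  where
  -- both images are signed enumerations read backwards
  signed≡ : L.map (signedZ (inBAR t)) js ≡ L.map (signedZ (inBAR t')) js'
  signed≡ = LP.reverse-injective (trans (sym (Φ-chain t rt ft js ns))
    (trans (cong Φ (sym C≡)) (trans ΦC≡ΦD (trans (cong Φ D≡) (Φ-chain t' rt' ft' js' ns')))))
  -- forgetting signs, the enumerations agree
  js≡ : js ≡ js'
  js≡ = LP.map-injective sucToℕ-inj
    (trans (sym (abs-signed (inBAR t) js)) (trans (cong (L.map ∣_∣) signed≡) (abs-signed (inBAR t') js')))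
  signed≡′ : L.map (signedZ (inBAR t)) js ≡ L.map (signedZ (inBAR t')) js
  signed≡′ = trans signed≡ (cong (L.map (signedZ (inBAR t'))) (sym js≡))
  -- every index is enumerated, so the signs give BAR(t) = BAR(t')
  bars≡ : ∀ i → inBAR t i ≡ inBAR t' i
  bars≡ i with enumerates-cover (λ _ → false) js ns i
  ... | inj₁ ()
  ... | inj₂ i∈js = signedZ-bar (inBAR t) (inBAR t') i (map-pointwise _ _ signed≡′ i∈js)
  flags≡ : flagChain t (λ _ → false) js ≡ flagChain t' (λ _ → false) js'
  flags≡ = cong₂ (λ a b → flagChain a (λ _ → false) b) (bar-det t t' rt rt' ft ft' bars≡) js≡

-- Surjectivity: a signed permutation π determines an enumeration js (the entries of π
-- read backwards) and a sign pattern bar (its negative entries); when bar has even size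
-- there is a full vector t with BAR(t) = bar, and the flag of t along js is mapped to π.
unique-↭ : ∀ {A : Set} {xs ys : List A} → xs ↭ ys → AllPairs _≢_ xs → AllPairs _≢_ ys
unique-↭ {A} p = PermS.Unique-resp-↭ (Perm.↭⇒↭ₛ p)
  where import Data.List.Relation.Binary.Permutation.Setoid.Properties (setoid A) as PermS

unique-map : ∀ {A B : Set} (f : A → B) {xs} → AllPairs _≢_ (L.map f xs) → ∀ {x y} → x ∈ xs → y ∈ xs → f x ≡ f y → x ≡ y
unique-map f {x ∷ xs} (a ∷ u) (here refl) (here refl) e = refl
unique-map f {x ∷ xs} (a ∷ u) (here refl) (there m) e = ⊥-elim (All.lookup a (∈-map⁺ f m) e)
unique-map f {x ∷ xs} (a ∷ u) (there m) (here refl) e = ⊥-elim (All.lookup a (∈-map⁺ f m) (sym e))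
unique-map f {x ∷ xs} (a ∷ u) (there m) (there m') e = unique-map f u m m' e

indexOf : ∀ {k} → ℕ → Fin (suc k)
indexOf {k} v with (v ∸ 1) <? suc k
... | yes p = fromℕ< p
... | no _ = zero

indexOf-idx : ∀ {k} (i : Fin (suc k)) → indexOf {k} (suc (toℕ i)) ≡ i
indexOf-idx {k} i with toℕ i <? suc k
... | yes p = fromℕ<-toℕ i p
... | no np = ⊥-elim (np (toℕ<n i))

memberᵇ : ℤ → List ℤ → Bool
memberᵇ z [] = false
memberᵇ z (x ∷ xs) = does (x ZP.≟ z) ∨ memberᵇ z xs

memberᵇ-sound : ∀ z xs → memberᵇ z xs ≡ true → z ∈ xs
memberᵇ-sound z (x ∷ xs) e with x ZP.≟ z
... | yes p = here (sym p)
... | no _ = there (memberᵇ-sound z xs e)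

memberᵇ-complete : ∀ z xs → z ∈ xs → memberᵇ z xs ≡ true
memberᵇ-complete z (x ∷ xs) (here p) with x ZP.≟ z
... | yes _ = refl
... | no np = ⊥-elim (np (sym p))
memberᵇ-complete z (x ∷ xs) (there m) with x ZP.≟ z
... | yes _ = refl
... | no _ = memberᵇ-complete z xs m

eqFin-false : ∀ {n} (i j : Fin n) → i ≢ j → eqFin i j ≡ false
eqFin-false i j ne with eqFin i j in e
... | true = ⊥-elim (ne (eqFin-≡ i j e))
... | false = refl

mkEnumerates : ∀ {n} (S : Fin n → Bool) js → AllPairs _≢_ js → (∀ j → j ∈ js → S j ≡ false) → (∀ i → S i ≡ true ⊎ i ∈ js) → Enumerates S js
mkEnumerates S [] u hf hc i with hc i
... | inj₁ e = e
... | inj₂ ()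
mkEnumerates S (j ∷ js) (a ∷ u) hf hc = hf j (here refl) , mkEnumerates (addIdx S j) js u hf' hc'
  where
  hf' : ∀ j' → j' ∈ js → addIdx S j j' ≡ false
  hf' j' m = trans (cong (_∨ eqFin j' j) (hf j' (there m))) (eqFin-false j' j (λ e → All.lookup a m (sym e)))
  hc' : ∀ i → addIdx S j i ≡ true ⊎ i ∈ js
  hc' i with hc i
  ... | inj₁ e = inj₁ (addIdx-mono S j i e)
  ... | inj₂ (there m) = inj₂ m
  ... | inj₂ (here refl) = inj₁ (addIdx-self S i)

module PermutationData {k : ℕ} (π : List ℤ) (P : L.map ∣_∣ π ↭ applyUpTo suc (suc k)) where
  n = suc k

  upTo-eq : applyUpTo suc n ≡ L.map (λ i → suc (toℕ i)) (allFin n)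
  upTo-eq = sym (allFin-upTo n)

  js : List (Fin n)
  js = L.map indexOf (L.map ∣_∣ (reverse π))

  indexOf-all : L.map (indexOf {k}) (applyUpTo suc n) ≡ allFin n
  indexOf-all = trans (cong (L.map indexOf) upTo-eq) (trans (sym (LP.map-∘ (allFin n)))
     (LP.map-id-local (All.tabulate (λ {i} _ → indexOf-idx i))))

  js-↭ : js ↭ allFin n
  js-↭ = ↭-trans (map⁺ indexOf (map⁺ ∣_∣ (↭-reverse π))) (↭-trans (map⁺ indexOf P) (↭-reflexive indexOf-all))

  uniqUpTo : AllPairs _≢_ (applyUpTo suc n)
  uniqUpTo = subst (AllPairs _≢_) (tab-upTo n suc) (tabulate⁺ (λ e → toℕ-injective (suc-injective e)))

  uniqAbs : AllPairs _≢_ (L.map ∣_∣ π)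
  uniqAbs = unique-↭ (↭-sym P) uniqUpTo

  bar : Fin n → Bool
  bar j = memberᵇ (- idxℤ j) π

  absIdx : ∀ z → z ∈ π → Σ (Fin n) λ i → ∣ z ∣ ≡ suc (toℕ i)
  absIdx z m with ∈-map⁻ (λ i → suc (toℕ i)) (subst (∣ z ∣ ∈_) upTo-eq (∈-resp-↭ P (∈-map⁺ ∣_∣ m)))
  ... | i , _ , e = i , e

  elem : ∀ z → z ∈ π → signedZ bar (indexOf ∣ z ∣) ≡ z
  elem z m with absIdx z m
  ... | i , e rewrite e | indexOf-idx {k} i = go z m e
    where
    go : ∀ z → z ∈ π → ∣ z ∣ ≡ suc (toℕ i) → signedZ bar i ≡ z
    go -[1+ v ] m e with suc-injective e
    ... | refl rewrite memberᵇ-complete (- idxℤ i) π m = refl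
    go (Z.+ u) m e with bar i in eb
    ... | false = cong Z.+_ (sym e)
    ... | true with unique-map ∣_∣ uniqAbs (memberᵇ-sound (- idxℤ i) π eb) m (sym e)
    ... | ()

  mapEq : L.map (signedZ bar) js ≡ reverse π
  mapEq = trans (sym (LP.map-∘ (L.map ∣_∣ (reverse π)))) (trans (sym (LP.map-∘ (reverse π)))
    (LP.map-id-local (All.tabulate (λ {z} m → elem z (∈-resp-↭ (↭-reverse π) m)))))

  negEq : negCount π ≡ countFin bar
  negEq = trans (negCount-↭ (↭-sym (↭-reverse π))) (trans (cong negCount (sym mapEq))
    (trans (negCount-↭ (map⁺ (signedZ bar) js-↭)) (trans (negCount-signed bar (allFin n)) (countList-allFin bar))))

  ns : Enumerates (λ _ → false) js
  ns = mkEnumerates (λ _ → false) js (unique-↭ (↭-sym js-↭) (allFin⁺ n))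
         (λ _ _ → refl) (λ i → inj₂ (∈-resp-↭ (↭-sym js-↭) (∈-allFin i)))

flipIf : Bool → Sign → Sign
flipIf b s = if b then negS s else s

signsWithFlips : ∀ {m} → Sign → (Fin m → Bool) → Vec Sign m
signsWithFlips {zero} s f = []
signsWithFlips {suc m} s f = flipIf (f zero) s ∷ signsWithFlips (flipIf (f zero) s) (λ i → f (suc i))

flipIf-nonzero : ∀ b s → NonZeroS s → NonZeroS (flipIf b s)
flipIf-nonzero true sm e = refl
flipIf-nonzero true sp e = refl
flipIf-nonzero false s e = e

signsWithFlips-full : ∀ {m} s (f : Fin m → Bool) → NonZeroS s → Full (s ∷ signsWithFlips s f)
signsWithFlips-full s f e zero = e
signsWithFlips-full {suc m} s f e (suc i) = signsWithFlips-full (flipIf (f zero) s) (λ i → f (suc i)) (flipIf-nonzero (f zero) s e) i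

signsWithFlips-step : ∀ {m} s (f : Fin m → Bool) (i : Fin m) → lookupℕ (s ∷ signsWithFlips s f) (suc (toℕ i)) ≡ flipIf (f i) (lookupℕ (s ∷ signsWithFlips s f) (toℕ i))
signsWithFlips-step s f zero = refl
signsWithFlips-step s f (suc i) = signsWithFlips-step (flipIf (f zero) s) (λ i → f (suc i)) i

minus-flipIf : ∀ x b → NonZeroS x → isMinus (x · flipIf b x) ≡ b
minus-flipIf sm true e = refl
minus-flipIf sm false e = refl
minus-flipIf sp true e = refl
minus-flipIf sp false e = refl
minus-flipIf s0 b ()

flipIf-flipIf : ∀ a b s → flipIf a (flipIf b s) ≡ flipIf (b xor a) s
flipIf-flipIf true true s = negS-inv s
flipIf-flipIf true false s = refl
flipIf-flipIf false true s = refl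
flipIf-flipIf false false s = refl

signsWithFlips-last : ∀ {m} s (f : Fin m → Bool) → NonZeroS s → lastNz (toList (s ∷ signsWithFlips s f)) ≡ just (flipIf (odd (countFin f)) s)
signsWithFlips-last {zero} sm f e = refl
signsWithFlips-last {zero} sp f e = refl
signsWithFlips-last {zero} s0 f ()
signsWithFlips-last {suc m} s f e = trans (lastNz-cons s (toList (signsWithFlips s f)))
  (trans (cong (_<∣> firstNz [ s ]) (signsWithFlips-last (flipIf (f zero) s) (λ i → f (suc i)) (flipIf-nonzero (f zero) s e)))
   (cong just (trans (flipIf-flipIf (odd (countFin (λ i → f (suc i)))) (f zero) s)
     (cong (λ b → flipIf b s) (sym (trans (odd-+ (ind (f zero)) _) (cong (_xor odd (countFin (λ i → f (suc i)))) (odd-ind (f zero)))))))))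

xor-false : ∀ a b → (a xor b) ≡ false → a ≡ b
xor-false true true e = refl
xor-false false false e = refl
xor-false true false ()
xor-false false true ()

-- FullVectorWithBar: for bar of even size, the full representative t with BAR(t) = bar:
-- t_0 = + and t_{i+1} = -t_i exactly when bar (i + 1); position 0 is then a flip iff an
-- odd number of later flips occurred, i.e. iff bar 0 holds.
module FullVectorWithBar {k : ℕ} (bar : Fin (suc k) → Bool) (ev : 2 ∣ countFin bar) where
  f : Fin k → Bool
  f i = bar (suc i)

  t : SignVec (suc k)
  t = sp ∷ signsWithFlips sp f

  ft : Full t
  ft = signsWithFlips-full sp f refl

  rt : Rep t
  rt = refl

  barEq : ∀ i → inBAR t i ≡ bar i
  barEq (suc i) = trans (inBAR-suc t ft i) (trans (cong (λ y → isMinus (lookupℕ t (toℕ i) · y)) (signsWithFlips-step sp f i))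
     (minus-flipIf (lookupℕ t (toℕ i)) (f i) (full-lookupℕ t ft (toℕ i) (<-trans (toℕ<n i) (n<1+n k)))))
  barEq zero = begin
    inBAR t zero
      ≡⟨ inBAR-char t zero ⟩
    opposes (lastNz (prefix t (suc k))) sp
      ≡⟨ cong (λ l → opposes l sp) (trans (cong lastNz (prefix-full t)) (signsWithFlips-last sp f refl)) ⟩
    opposes (just (flipIf (odd (countFin f)) sp)) sp
      ≡⟨ opposes-flipIf (odd (countFin f)) ⟩
    odd (countFin f)
      ≡⟨ odd-rest ⟩
    bar zero ∎
    where
    open ≡-Reasoning
    opposes-flipIf : ∀ b → opposes (just (flipIf b sp)) sp ≡ b
    opposes-flipIf true = refl
    opposes-flipIf false = refl
    -- as |bar| is even, the number of later flips has the parity of bar 0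
    parity : odd (countFin bar) ≡ bar zero xor odd (countFin f)
    parity = trans (odd-+ (ind (bar zero)) (countFin f)) (cong (_xor odd (countFin f)) (odd-ind (bar zero)))
    odd-rest : odd (countFin f) ≡ bar zero
    odd-rest = sym (xor-false (bar zero) (odd (countFin f)) (trans (sym parity) (even⇒¬odd _ ev)))

signChanges-length : ∀ l k → length l ≤ suc k → signChanges l ≤ k
signChanges-length [] k _ = z≤n
signChanges-length (x ∷ []) k _ = z≤n
signChanges-length (x ∷ y ∷ l) (suc k) (s≤s le) = subst (_≤ suc k) (sym (changes-cons x y l)) (+-mono-≤ (ind≤1 (isMinus (x · y))) (signChanges-length (y ∷ l) k le))
signChanges-length (x ∷ y ∷ l) zero (s≤s ())

len-nz : ∀ {n} (ω : SignVec n) → length (nonzeros ω) ≤ n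
len-nz [] = z≤n
len-nz (sm ∷ ω) = s≤s (len-nz ω)
len-nz (s0 ∷ ω) = m≤n⇒m≤1+n (len-nz ω)
len-nz (sp ∷ ω) = s≤s (len-nz ω)

var≤length : ∀ {k} (ω : SignVec (suc k)) → var ω ≤ k
var≤length {k} ω = signChanges-length (nonzeros ω) k (len-nz ω)

cyclicChanges-≥ : ∀ l → All NonZeroS l → signChanges l ≤ cyclicChanges l
cyclicChanges-≥ [] a = z≤n
cyclicChanges-≥ (y ∷ ys) a rewrite cyclicChanges-cons y ys a = m≤n+m _ _

var≤countBAR : ∀ {k} (ω : SignVec (suc k)) → var ω ≤ countFin (inBAR ω)
var≤countBAR ω = subst (var ω ≤_) (sym (countBAR ω)) (cyclicChanges-≥ (nonzeros ω) (allNz ω))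

countFin-false : ∀ {n} → countFin {n} (λ _ → false) ≡ 0
countFin-false {zero} = refl
countFin-false {suc n} = countFin-false {n}

facet-surj : ∀ {k} m (π : List ℤ) → InSD (suc k) π →
  (∀ (t : SignVec (suc k)) → countFin (inBAR t) ≡ negCount π → var t ≤ m) →
  Σ (List (PV (suc k))) λ C → IsFacet m C × Φ C ≡ π
facet-surj {k} m π (P , ev) hv = C , full-face-is-facet m C face lenC , phiC
  where
  open PermutationData π P
  ev' : 2 ∣ countFin bar
  ev' = subst (2 ∣_) negEq ev
  open FullVectorWithBar bar ev' using (t; ft; rt; barEq)
  vt : var t ≤ m
  vt = hv t (trans (countFin-cong barEq) (sym negEq))
  C = flagChain t (λ _ → false) js
  face = chain-face m t (λ _ → false) js ft vt ns
  lenC : length C ≡ suc k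
  lenC = trans (flagChain-length t (λ _ → false) js) (trans (sym (+-identityʳ (length js)))
           (trans (cong (length js +_) (sym (countFin-false {suc k}))) (enumerates-length (λ _ → false) js ns)))
  phiC : Φ C ≡ π
  phiC = trans (Φ-chain t rt ft js ns) (trans (cong reverse (trans (LP.map-cong (λ j → cong (λ b → if b then - idxℤ j else idxℤ j) (barEq j)) js) mapEq))
           (LP.reverse-involutive π))

phiClaim : ∀ {k} m (S : List ℤ → Set) →
  ((C : List (PV (suc k))) → IsFace m C → S (Φ C)) →
  ((π : List ℤ) → S π → InSD (suc k) π ×
     ((t : SignVec (suc k)) → countFin (inBAR t) ≡ negCount π → var t ≤ m)) →
  PhiClaim (suc k) m S
phiClaim {k} m S face⇒S S⇒realisable =
  (λ C f → face⇒S C (proj₁ f)) , facet-inj m , onto , face⇒S ,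
  (λ π s → let (C , f , e) = onto π s in C , proj₁ f , e)
  where
  onto : (π : List ℤ) → S π → Σ (List (PV (suc k))) λ C → IsFacet m C × Φ C ≡ π
  onto π s = facet-surj m π (proj₁ (S⇒realisable π s)) (proj₂ (S⇒realisable π s))

lemma3p6 : (n : ℕ) → 1 ≤ n →
    PhiClaim n (n ∸ 1) (InSD n) ×
    ((m : ℕ) → m ≤ n ∸ 1 → 2 ∣ m → PhiClaim n m (InSDm n m))
lemma3p6 (suc k) _ =
  phiClaim k (InSD (suc k)) (face-SD k) (λ π π∈S → π∈S , λ t _ → var≤length t) ,
  λ m _ m-even → phiClaim m (InSDm (suc k) m) (λ C → face-SDm m C m-even)
    (λ π (π∈S , neg≤m) → π∈S , λ t flips≡neg →
       ≤-trans (var≤countBAR t) (subst (_≤ m) (sym flips≡neg) neg≤m))
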